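{- For all $n,k$, let $t(n,k)$ be the number of partitions $\pi=\pi_1\cdots\pi_n$ of $[n]$ that avoid the pattern $1123$ and satisfy $\pi_n=k$, and let $t'(n,k)$ be the number of Dyck paths of semilength $n$ whose last up-step is followed by exactly $k$ down-steps. Then $t(n,k)=t'(n,k)$.
   Context: Partitions of $[n]$ are identified with canonical sequences $\pi_1\cdots\pi_n$ ($\pi_i=j$ iff $i$ lies in the $j$-th block, blocks ordered by increasing minima). A partition contains a pattern $\sigma$ if it has a subsequence order-isomorphic to $\sigma$, and avoids it otherwise. A Dyck path of semilength $n$ is a lattice path from $(0,0)$ to $(2n,0)$ with up-steps $(1,1)$ and down-steps $(1,-1)$ that never goes below the $x$-axis. -}

module Defs where

open import Data.Nat using (ℕ; zero; suc; _+_; _*_; _⊔_; _≡ᵇ_; _<ᵇ_)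
open import Data.Bool using (Bool; true; false; _∧_; _∨_; not)
open import Data.List using (List; []; _∷_; _++_; map; length; filterᵇ; concatMap; applyUpTo; zip; replicate)
open import Data.Product using (_,_)
open import Data.Bool.ListAction using (all; any)

count : {A : Set} → (A → Bool) → List A → ℕ
count p xs = length (filterᵇ p xs)

listsOver : {A : Set} → List A → ℕ → List (List A)
listsOver vals zero    = [] ∷ []
listsOver vals (suc n) = concatMap (λ x → map (x ∷_) (listsOver vals n)) vals

-- Set partitions of [n] as canonical sequences (restricted growth)

canonicalFrom : ℕ → List ℕ → Bool
canonicalFrom m []       = true
canonicalFrom m (x ∷ xs) = not (x ≡ᵇ 0) ∧ (x <ᵇ suc (suc m)) ∧ canonicalFrom (m ⊔ x) xs

isCanonical : List ℕ → Bool
isCanonical = canonicalFrom 0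

partitions : ℕ → List (List ℕ)
partitions n = filterᵇ isCanonical (listsOver (applyUpTo suc n) n)

subseqs : {A : Set} → List A → List (List A)
subseqs []       = [] ∷ []
subseqs (x ∷ xs) = map (x ∷_) (subseqs xs) ++ subseqs xs

_==_ : Bool → Bool → Bool
true  == b = b
false == b = not b

orderIso : List ℕ → List ℕ → Bool
orderIso []       []       = true
orderIso (x ∷ xs) (y ∷ ys) =
  all (λ { (x' , y') → ((x <ᵇ x') == (y <ᵇ y')) ∧ ((x' <ᵇ x) == (y' <ᵇ y)) })
      (zip xs ys)
  ∧ orderIso xs ys
orderIso _        _        = false

contains : List ℕ → List ℕ → Bool
contains π σ = any (λ s → orderIso s σ) (subseqs π)

avoids : List ℕ → List ℕ → Bool
avoids π σ = not (contains π σ)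

lastIs : ℕ → List ℕ → Bool
lastIs k []           = false
lastIs k (x ∷ [])     = x ≡ᵇ k
lastIs k (_ ∷ y ∷ ys) = lastIs k (y ∷ ys)

t : ℕ → ℕ → ℕ
t n k = count (λ π → avoids π (1 ∷ 1 ∷ 2 ∷ 3 ∷ []) ∧ lastIs k π) (partitions n)

data Step : Set where
  U D : Step

dyckFrom : ℕ → List Step → Bool
dyckFrom zero    []       = true
dyckFrom (suc h) []       = false
dyckFrom h       (U ∷ s)  = dyckFrom (suc h) s
dyckFrom zero    (D ∷ s)  = false
dyckFrom (suc h) (D ∷ s)  = dyckFrom h s

isDyck : List Step → Bool
isDyck = dyckFrom 0

dyckPaths : ℕ → List (List Step)
dyckPaths n = filterᵇ isDyck (listsOver (U ∷ D ∷ []) (n + n))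

onlyDs : List Step → Bool
onlyDs []      = true
onlyDs (U ∷ s) = false
onlyDs (D ∷ s) = onlyDs s

lastUpFollowedBy : ℕ → List Step → Bool
lastUpFollowedBy k []      = false
lastUpFollowedBy k (U ∷ s) = (onlyDs s ∧ (length s ≡ᵇ k)) ∨ lastUpFollowedBy k s
lastUpFollowedBy k (D ∷ s) = lastUpFollowedBy k s

t′ : ℕ → ℕ → ℕ
t′ n k = count (lastUpFollowedBy k) (dyckPaths n)

-- Both sides satisfy one recurrence. Deleting the final peak of a Dyck path gives
-- t′(n+2, k+1) = Σ_{j ≥ k} t′(n+1, j). On the partition side, a canonical 1123-avoiding prefix is
-- summarised by its maximum m, its least repeated entry and the least c occurring in some a a c with
-- a < c; the admissible next entries are then exactly 1, …, b, where b is that c (or m + 1 if there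
-- is none), so t(n+1, k) counts the prefixes of length n with b ≥ k. Sorting prefixes by whether the
-- entry 1 is repeated (if not, the prefix is 1 followed by a shifted prefix one shorter) and by their
-- last entry yields recurrences for these counts that match the Dyck one, by simultaneous induction.

module Submission where

open import Defs
open import Algebra.Bundles using (CommutativeMonoid)
import Algebra.Properties.CommutativeSemigroup as CommutativeSemigroupProperties
open import Data.Bool using (Bool; true; false; _∧_; _∨_; not; if_then_else_; T)
open import Data.Bool.ListAction using (any)
open import Data.Bool.Properties
  using (∧-zeroʳ; ∧-identityʳ; ∧-assoc; ∧-distribˡ-∨; ∧-distribʳ-∨; ∨-zeroʳ; ∨-identityʳ; ∨-assoc; ∨-comm;
         ∨-commutativeMonoid; not-injective)
open import Data.Empty using (⊥-elim)
open import Data.List using (List; []; _∷_; _++_; _∷ʳ_; [_]; map; concatMap; filterᵇ; applyUpTo; null; length; foldl)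
open import Data.List.Properties using (++-assoc; ++-identityʳ; foldl-∷ʳ; concatMap-map; concatMap-pure)
open import Data.List.Relation.Unary.All as All using (All; []; _∷_)
open import Data.List.Relation.Unary.All.Properties using (concat⁺; map⁺)
open import Data.Maybe as Maybe using (Maybe; just; nothing)
open import Data.Maybe.Relation.Unary.All as MaybeAll using (just; nothing)
open import Data.Nat using (ℕ; zero; suc; _+_; _*_; _∸_; _⊔_; _⊓_; _≡ᵇ_; _<ᵇ_; _≤ᵇ_; _≤_; _<_; z≤n; s≤s)
open import Data.Nat.Properties
open import Data.Nat.Solver using (module +-*-Solver)
open import Data.Product using (_×_; _,_; proj₁)
open import Data.Sum using (inj₁; inj₂)
open import Function using (_∘_)
open import Relation.Binary.Definitions using (tri<; tri≈; tri>)
open import Relation.Binary.PropositionalEquality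
  using (_≡_; _≢_; refl; sym; trans; cong; cong₂; subst; module ≡-Reasoning)
open import Relation.Nullary.Reflects using (Reflects; ofʸ; ofⁿ; det; fromEquivalence)

open +-*-Solver using (solve; _:=_; _:+_)
open CommutativeSemigroupProperties (CommutativeMonoid.commutativeSemigroup ∨-commutativeMonoid)
  using () renaming (interchange to ∨-interchange)

private variable
  A B : Set

∧≡true⇒ˡ : ∀ {a b} → a ∧ b ≡ true → a ≡ true
∧≡true⇒ˡ {true} _ = refl

∧≡true⇒ʳ : ∀ {a b} → a ∧ b ≡ true → b ≡ true
∧≡true⇒ʳ {true} b = b

≡true⇒T : ∀ {b} → b ≡ true → T b
≡true⇒T refl = _

𝟙 : Bool → ℕ
𝟙 true  = 1
𝟙 false = 0

𝟙-split : ∀ b c → 𝟙 c ≡ 𝟙 (not b) * 𝟙 c + 𝟙 (b ∧ c)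
𝟙-split true  c = refl
𝟙-split false c = sym (trans (+-identityʳ _) (+-identityʳ _))

sumBy : (A → ℕ) → List A → ℕ
sumBy f []       = 0
sumBy f (x ∷ xs) = f x + sumBy f xs

sumBy-cong : {f g : A → ℕ} → (∀ x → f x ≡ g x) → ∀ xs → sumBy f xs ≡ sumBy g xs
sumBy-cong f≗g []       = refl
sumBy-cong f≗g (x ∷ xs) = cong₂ _+_ (f≗g x) (sumBy-cong f≗g xs)

sumBy-cong-All : ∀ {f g : A → ℕ} {xs} → All (λ x → f x ≡ g x) xs → sumBy f xs ≡ sumBy g xs
sumBy-cong-All []           = refl
sumBy-cong-All (fx≡gx ∷ eq) = cong₂ _+_ fx≡gx (sumBy-cong-All eq)

sumBy-zero : (xs : List A) → sumBy (λ _ → 0) xs ≡ 0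
sumBy-zero []       = refl
sumBy-zero (x ∷ xs) = sumBy-zero xs

sumBy-++ : (f : A → ℕ) (xs ys : List A) → sumBy f (xs ++ ys) ≡ sumBy f xs + sumBy f ys
sumBy-++ f []       ys = refl
sumBy-++ f (x ∷ xs) ys = trans (cong (f x +_) (sumBy-++ f xs ys)) (sym (+-assoc (f x) _ _))

sumBy-map : (f : B → ℕ) (g : A → B) (xs : List A) → sumBy f (map g xs) ≡ sumBy (λ x → f (g x)) xs
sumBy-map f g []       = refl
sumBy-map f g (x ∷ xs) = cong (f (g x) +_) (sumBy-map f g xs)

sumBy-concatMap : (f : B → ℕ) (g : A → List B) (xs : List A) →
                  sumBy f (concatMap g xs) ≡ sumBy (λ x → sumBy f (g x)) xs
sumBy-concatMap f g []       = refl
sumBy-concatMap f g (x ∷ xs) =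
  trans (sumBy-++ f (g x) (concatMap g xs)) (cong (sumBy f (g x) +_) (sumBy-concatMap f g xs))

sumBy-+ : (f g : A → ℕ) (xs : List A) → sumBy (λ x → f x + g x) xs ≡ sumBy f xs + sumBy g xs
sumBy-+ f g []       = refl
sumBy-+ f g (x ∷ xs) rewrite sumBy-+ f g xs =
  solve 4 (λ a b c d → (a :+ b) :+ (c :+ d) := (a :+ c) :+ (b :+ d)) refl (f x) (g x) (sumBy f xs) (sumBy g xs)

count-∷ : (p : A → Bool) (x : A) (xs : List A) → count p (x ∷ xs) ≡ 𝟙 (p x) + count p xs
count-∷ p x xs with p x
... | true  = refl
... | false = refl

count≡sumBy : (p : A → Bool) (xs : List A) → count p xs ≡ sumBy (λ x → 𝟙 (p x)) xs
count≡sumBy p []       = refl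
count≡sumBy p (x ∷ xs) = trans (count-∷ p x xs) (cong (𝟙 (p x) +_) (count≡sumBy p xs))

count-cong : {p q : A → Bool} → (∀ x → p x ≡ q x) → ∀ xs → count p xs ≡ count q xs
count-cong {p = p} {q} p≗q xs = begin
  count p xs                ≡⟨ count≡sumBy p xs ⟩
  sumBy (λ x → 𝟙 (p x)) xs  ≡⟨ sumBy-cong (λ x → cong 𝟙 (p≗q x)) xs ⟩
  sumBy (λ x → 𝟙 (q x)) xs  ≡⟨ count≡sumBy q xs ⟨
  count q xs                ∎
  where open ≡-Reasoning

count-cong-All : ∀ {p q : A → Bool} {xs} → All (λ x → p x ≡ q x) xs → count p xs ≡ count q xs
count-cong-All {p = p} {q} {xs} eq =
  trans (count≡sumBy p xs) (trans (sumBy-cong-All (All.map (cong 𝟙) eq)) (sym (count≡sumBy q xs)))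

count-none : (p : A → Bool) → (∀ x → p x ≡ false) → ∀ xs → count p xs ≡ 0
count-none p none xs = trans (count-cong none xs) (trans (count≡sumBy _ xs) (sumBy-zero xs))

count-map : (p : B → Bool) (f : A → B) (xs : List A) → count p (map f xs) ≡ count (λ x → p (f x)) xs
count-map p f xs =
  trans (count≡sumBy p (map f xs)) (trans (sumBy-map _ f xs) (sym (count≡sumBy _ xs)))

count-concatMap : (p : B → Bool) (f : A → List B) (xs : List A) →
                  count p (concatMap f xs) ≡ sumBy (λ x → count p (f x)) xs
count-concatMap p f xs =
  trans (count≡sumBy p (concatMap f xs))
        (trans (sumBy-concatMap _ f xs) (sumBy-cong (λ x → sym (count≡sumBy p (f x))) xs))

count-filterᵇ : (p q : A → Bool) (xs : List A) → count p (filterᵇ q xs) ≡ count (λ x → q x ∧ p x) xs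
count-filterᵇ p q []       = refl
count-filterᵇ p q (x ∷ xs) = begin
  count p (filterᵇ q (x ∷ xs))               ≡⟨ head ⟩
  𝟙 (q x ∧ p x) + count p (filterᵇ q xs)     ≡⟨ cong (𝟙 (q x ∧ p x) +_) (count-filterᵇ p q xs) ⟩
  𝟙 (q x ∧ p x) + count (λ x → q x ∧ p x) xs ≡⟨ count-∷ _ x xs ⟨
  count (λ x → q x ∧ p x) (x ∷ xs)           ∎
  where
  open ≡-Reasoning
  head : count p (filterᵇ q (x ∷ xs)) ≡ 𝟙 (q x ∧ p x) + count p (filterᵇ q xs)
  head with q x
  ... | true  = count-∷ p x _
  ... | false = refl

count-∨ : {p q : A → Bool} → (∀ x → p x ≡ true → q x ≡ false) →
          ∀ xs → count (λ x → p x ∨ q x) xs ≡ count p xs + count q xs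
count-∨ {p = p} {q} disjoint xs = begin
  count (λ x → p x ∨ q x) xs                          ≡⟨ count≡sumBy _ xs ⟩
  sumBy (λ x → 𝟙 (p x ∨ q x)) xs                      ≡⟨ sumBy-cong (λ x → 𝟙-∨ (p x) (q x) (disjoint x)) xs ⟩
  sumBy (λ x → 𝟙 (p x) + 𝟙 (q x)) xs                  ≡⟨ sumBy-+ _ _ xs ⟩
  sumBy (λ x → 𝟙 (p x)) xs + sumBy (λ x → 𝟙 (q x)) xs ≡⟨ cong₂ _+_ (count≡sumBy p xs) (count≡sumBy q xs) ⟨
  count p xs + count q xs                             ∎
  where
  open ≡-Reasoning
  𝟙-∨ : ∀ a b → (a ≡ true → b ≡ false) → 𝟙 (a ∨ b) ≡ 𝟙 a + 𝟙 b
  𝟙-∨ true  b a⇒¬b rewrite a⇒¬b refl = refl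
  𝟙-∨ false b _    = refl

count-∧ˡ : (b : Bool) (q : A → Bool) (xs : List A) → count (λ x → b ∧ q x) xs ≡ 𝟙 b * count q xs
count-∧ˡ true  q xs = sym (+-identityʳ _)
count-∧ˡ false q xs = count-none _ (λ _ → refl) xs

count-listsOver-suc : (p : List A → Bool) (vals : List A) (r : ℕ) →
                      count p (listsOver vals (suc r)) ≡ sumBy (λ y → count (λ w → p (y ∷ w)) (listsOver vals r)) vals
count-listsOver-suc p vals r =
  trans (count-concatMap p (λ y → map (y ∷_) (listsOver vals r)) vals)
        (sumBy-cong (λ y → count-map p (y ∷_) (listsOver vals r)) vals)

count-listsOver-suc-cong : {p q : List A → Bool} → (∀ z w → p (z ∷ w) ≡ q (z ∷ w)) →
                           ∀ vals r → count p (listsOver vals (suc r)) ≡ count q (listsOver vals (suc r))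
count-listsOver-suc-cong {p = p} {q} p≗q vals r =
  trans (count-listsOver-suc p vals r)
        (trans (sumBy-cong (λ z → count-cong (p≗q z) (listsOver vals r)) vals) (sym (count-listsOver-suc q vals r)))

≡ᵇ-reflects-≡ : ∀ m n → Reflects (m ≡ n) (m ≡ᵇ n)
≡ᵇ-reflects-≡ m n = fromEquivalence (≡ᵇ⇒≡ m n) (≡⇒≡ᵇ m n)

≤ᵇ-suc : ∀ k L → (suc k ≤ᵇ suc L) ≡ (k ≤ᵇ L)
≤ᵇ-suc zero    L = refl
≤ᵇ-suc (suc k) L = refl

𝟙-≤ᵇ-split : ∀ k L → 𝟙 (k ≤ᵇ L) ≡ 𝟙 (L ≡ᵇ k) + 𝟙 (suc k ≤ᵇ L)
𝟙-≤ᵇ-split zero    zero    = refl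
𝟙-≤ᵇ-split zero    (suc L) = refl
𝟙-≤ᵇ-split (suc k) zero    = refl
𝟙-≤ᵇ-split (suc k) (suc L) rewrite ≤ᵇ-suc k L | ≤ᵇ-suc (suc k) L = 𝟙-≤ᵇ-split k L

𝟙-∧-≤ᵇ-split : ∀ c k L → 𝟙 (c ∧ (k ≤ᵇ L)) ≡ 𝟙 (c ∧ (L ≡ᵇ k)) + 𝟙 (c ∧ (suc k ≤ᵇ L))
𝟙-∧-≤ᵇ-split false k L = refl
𝟙-∧-≤ᵇ-split true  k L = 𝟙-≤ᵇ-split k L

∸-split : ∀ L c → L ∸ c ≡ 𝟙 (suc c ≤ᵇ L) + (L ∸ suc c)
∸-split zero    zero    = refl
∸-split zero    (suc c) = refl
∸-split (suc L) zero    = refl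
∸-split (suc L) (suc c) = trans (∸-split L c) (cong (λ b → 𝟙 b + (L ∸ suc c)) (sym (≤ᵇ-suc (suc c) L)))

range : ℕ → ℕ → List ℕ
range a zero    = []
range a (suc n) = a ∷ range (suc a) n

All-range : ∀ a n → All (λ y → a ≤ y × y < a + n) (range a n)
All-range a zero    = []
All-range a (suc n) =
  (≤-refl , subst (a <_) (sym (+-suc a n)) (s≤s (m≤m+n a n)))
  ∷ All.map (λ {y} (a<y , y<) → <⇒≤ a<y , subst (y <_) (sym (+-suc a n)) y<) (All-range (suc a) n)

sumBy-cong-range : ∀ a n {f g : ℕ → ℕ} → (∀ y → a ≤ y → y < a + n → f y ≡ g y) →
                   sumBy f (range a n) ≡ sumBy g (range a n)
sumBy-cong-range a n f≗g = sumBy-cong-All (All.map (λ {y} (a≤y , y<a+n) → f≗g y a≤y y<a+n) (All-range a n))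

range-++ : ∀ a n m → range a (n + m) ≡ range a n ++ range (a + n) m
range-++ a zero    m = cong (λ b → range b m) (sym (+-identityʳ a))
range-++ a (suc n) m =
  cong (a ∷_) (trans (range-++ (suc a) n m) (cong (λ b → range (suc a) n ++ range b m) (sym (+-suc a n))))

range-suc : ∀ a n → range (suc a) n ≡ map suc (range a n)
range-suc a zero    = refl
range-suc a (suc n) = cong (suc a ∷_) (range-suc (suc a) n)

applyUpTo-suc : ∀ n → applyUpTo suc n ≡ range 1 n
applyUpTo-suc n = go 1 n (λ _ → refl)
  where
  go : ∀ a n {f : ℕ → ℕ} → (∀ i → f i ≡ a + i) → applyUpTo f n ≡ range a n
  go a zero    f≗ = refl
  go a (suc n) f≗ = cong₂ _∷_ (trans (f≗ 0) (+-identityʳ a)) (go (suc a) n (λ i → trans (f≗ (suc i)) (+-suc a i)))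

count-range-suc : (p : ℕ → Bool) (a n : ℕ) → count p (range (suc a) n) ≡ count (p ∘ suc) (range a n)
count-range-suc p a n = trans (cong (count p) (range-suc a n)) (count-map p suc (range a n))

count-≡ᵇ-range : ∀ a k n → count (_≡ᵇ a + k) (range a n) ≡ 𝟙 (k <ᵇ n)
count-≡ᵇ-range zero    k       zero    = refl
count-≡ᵇ-range zero    zero    (suc n) =
  cong suc (trans (count-range-suc _ 0 n) (count-none _ (λ _ → refl) (range 0 n)))
count-≡ᵇ-range zero    (suc k) (suc n) = trans (count-range-suc _ 0 n) (count-≡ᵇ-range 0 k n)
count-≡ᵇ-range (suc a) k       n       = trans (count-range-suc _ a n) (count-≡ᵇ-range a k n)

count-≤ᵇ-range : ∀ a c n → count (λ y → a + c ≤ᵇ y) (range a n) ≡ n ∸ c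
count-≤ᵇ-range zero    c       zero    = sym (0∸n≡0 c)
count-≤ᵇ-range zero    zero    (suc n) = cong suc (trans (count-range-suc _ 0 n) (count-≤ᵇ-range 0 0 n))
count-≤ᵇ-range zero    (suc c) (suc n) =
  trans (count-range-suc _ 0 n) (trans (count-cong (λ y → ≤ᵇ-suc c y) (range 0 n)) (count-≤ᵇ-range 0 c n))
count-≤ᵇ-range (suc a) c       n       =
  trans (count-range-suc _ a n) (trans (count-cong (λ y → ≤ᵇ-suc (a + c) y) (range a n)) (count-≤ᵇ-range a c n))

sumBy-range-restrict : ∀ M N (f : ℕ → ℕ) → M ≤ N →
  sumBy (λ y → 𝟙 ((1 ≤ᵇ y) ∧ (y ≤ᵇ M)) * f y) (range 1 N) ≡ sumBy f (range 1 M)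
sumBy-range-restrict M N f M≤N = begin
  sumBy F (range 1 N)
    ≡⟨ cong (sumBy F) (trans (cong (range 1) (sym (m+[n∸m]≡n M≤N))) (range-++ 1 M (N ∸ M))) ⟩
  sumBy F (range 1 M ++ range (1 + M) (N ∸ M))
    ≡⟨ sumBy-++ F (range 1 M) _ ⟩
  sumBy F (range 1 M) + sumBy F (range (1 + M) (N ∸ M))
    ≡⟨ cong₂ _+_ (sumBy-cong-range 1 M inside)
                 (trans (sumBy-cong-range (1 + M) (N ∸ M) outside) (sumBy-zero (range (1 + M) (N ∸ M)))) ⟩
  sumBy f (range 1 M) + 0
    ≡⟨ +-identityʳ _ ⟩
  sumBy f (range 1 M) ∎
  where
  open ≡-Reasoning
  F : ℕ → ℕ
  F y = 𝟙 ((1 ≤ᵇ y) ∧ (y ≤ᵇ M)) * f y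
  inside : ∀ y → 1 ≤ y → y < 1 + M → F y ≡ f y
  inside y 1≤y y≤M rewrite det (≤ᵇ-reflects-≤ 1 y) (ofʸ 1≤y) | det (≤ᵇ-reflects-≤ y M) (ofʸ (≤-pred y≤M)) =
    +-identityʳ _
  outside : ∀ y → 1 + M ≤ y → y < 1 + M + (N ∸ M) → F y ≡ 0
  outside y M<y _ rewrite det (≤ᵇ-reflects-≤ y M) (ofⁿ (<⇒≱ M<y)) = cong (λ b → 𝟙 b * f y) (∧-zeroʳ (1 ≤ᵇ y))

-- Dyck paths

atPred : (ℕ → ℕ) → ℕ → ℕ
atPred f zero    = 0
atPred f (suc h) = f h

atPred-cong : ∀ {f g : ℕ → ℕ} → (∀ h → f h ≡ g h) → ∀ h → atPred f h ≡ atPred g h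
atPred-cong f≗g zero    = refl
atPred-cong f≗g (suc h) = f≗g h

atPred-+ : ∀ (f g : ℕ → ℕ) h → atPred (λ h′ → f h′ + g h′) h ≡ atPred f h + atPred g h
atPred-+ f g zero    = refl
atPred-+ f g (suc h) = refl

-- By count-dyck, paths h L k counts the Dyck words of length L starting at height h whose last
-- up-step is followed by exactly k steps. The recursion splits on the first step; its middle term is
-- the word U D⋯D.
paths : ℕ → ℕ → ℕ → ℕ
paths h zero    k = 0
paths h (suc L) k = paths (suc h) L k + 𝟙 ((L ≡ᵇ suc h) ∧ (L ≡ᵇ k)) + atPred (λ h′ → paths h′ L k) h

-- Σ_{j ≥ k} paths h L j (paths≥-split).
paths≥ : ℕ → ℕ → ℕ → ℕ
paths≥ h zero    k = 0
paths≥ h (suc L) k = paths≥ (suc h) L k + 𝟙 ((L ≡ᵇ suc h) ∧ (k ≤ᵇ L)) + atPred (λ h′ → paths≥ h′ L k) h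

UD : List Step
UD = U ∷ D ∷ []

count-listsOver-UD : (p : List Step → Bool) (L : ℕ) →
  count p (listsOver UD (suc L)) ≡ count (λ w → p (U ∷ w)) (listsOver UD L) + count (λ w → p (D ∷ w)) (listsOver UD L)
count-listsOver-UD p L =
  trans (count-listsOver-suc p UD L) (cong (count (λ w → p (U ∷ w)) (listsOver UD L) +_) (+-identityʳ _))

dyckFrom-U : ∀ h w → dyckFrom h (U ∷ w) ≡ dyckFrom (suc h) w
dyckFrom-U zero    w = refl
dyckFrom-U (suc h) w = refl

count-dyckFrom-D : ∀ h (q : List Step → Bool) ws →
  count (λ w → dyckFrom h (D ∷ w) ∧ q w) ws ≡ atPred (λ h′ → count (λ w → dyckFrom h′ w ∧ q w) ws) h
count-dyckFrom-D zero    q ws = count-none _ (λ _ → refl) ws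
count-dyckFrom-D (suc h) q ws = refl

count-descent : ∀ L h k →
  count (λ w → dyckFrom h w ∧ (onlyDs w ∧ (length w ≡ᵇ k))) (listsOver UD L) ≡ 𝟙 ((L ≡ᵇ h) ∧ (L ≡ᵇ k))
count-descent zero    zero    zero    = refl
count-descent zero    zero    (suc k) = refl
count-descent zero    (suc h) k       = refl
count-descent (suc L) h       k       = begin
  count P (listsOver UD (suc L))
    ≡⟨ count-listsOver-UD P L ⟩
  count (λ w → P (U ∷ w)) ls + count (λ w → P (D ∷ w)) ls
    ≡⟨ cong (_+ count (λ w → P (D ∷ w)) ls) (count-none _ (λ w → ∧-zeroʳ (dyckFrom h (U ∷ w))) ls) ⟩
  count (λ w → P (D ∷ w)) ls
    ≡⟨ afterD k ⟩
  𝟙 ((suc L ≡ᵇ h) ∧ (suc L ≡ᵇ k)) ∎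
  where
  open ≡-Reasoning
  ls : List (List Step)
  ls = listsOver UD L
  P : List Step → Bool
  P w = dyckFrom h w ∧ (onlyDs w ∧ (length w ≡ᵇ k))
  afterD : ∀ k → count (λ w → dyckFrom h (D ∷ w) ∧ (onlyDs w ∧ (suc (length w) ≡ᵇ k))) ls
                 ≡ 𝟙 ((suc L ≡ᵇ h) ∧ (suc L ≡ᵇ k))
  afterD zero    =
    trans (count-none _ (λ w → trans (cong (dyckFrom h (D ∷ w) ∧_) (∧-zeroʳ (onlyDs w))) (∧-zeroʳ _)) ls)
          (cong 𝟙 (sym (∧-zeroʳ (suc L ≡ᵇ h))))
  afterD (suc k) = trans (count-dyckFrom-D h _ ls) (atPred-descent h)
    where
    atPred-descent : ∀ h → atPred (λ h′ → count (λ w → dyckFrom h′ w ∧ (onlyDs w ∧ (length w ≡ᵇ k))) ls) h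
                           ≡ 𝟙 ((suc L ≡ᵇ h) ∧ (L ≡ᵇ k))
    atPred-descent zero    = refl
    atPred-descent (suc h) = count-descent L h k

onlyDs⇒¬lastUpFollowedBy : ∀ k w → onlyDs w ≡ true → lastUpFollowedBy k w ≡ false
onlyDs⇒¬lastUpFollowedBy k []      _  = refl
onlyDs⇒¬lastUpFollowedBy k (D ∷ w) ds = onlyDs⇒¬lastUpFollowedBy k w ds

count-dyck : ∀ L h k → count (λ w → dyckFrom h w ∧ lastUpFollowedBy k w) (listsOver UD L) ≡ paths h L k
count-dyck zero    h k = trans (count-∷ (λ w → dyckFrom h w ∧ lastUpFollowedBy k w) [] [])
                                (cong (λ b → 𝟙 b + 0) (∧-zeroʳ (dyckFrom h [])))
count-dyck (suc L) h k = begin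
  count P (listsOver UD (suc L))
    ≡⟨ count-listsOver-UD P L ⟩
  count (λ w → P (U ∷ w)) ls + count (λ w → P (D ∷ w)) ls
    ≡⟨ cong (_+ count (λ w → P (D ∷ w)) ls) (count-cong (λ w → afterU w) ls) ⟩
  count (λ w → descent w ∨ later w) ls + count (λ w → P (D ∷ w)) ls
    ≡⟨ cong (_+ count (λ w → P (D ∷ w)) ls) (count-∨ disjoint ls) ⟩
  count descent ls + count later ls + count (λ w → P (D ∷ w)) ls
    ≡⟨ cong₂ _+_ (+-comm (count descent ls) (count later ls)) (count-dyckFrom-D h _ ls) ⟩
  count later ls + count descent ls + atPred (λ h′ → count (λ w → dyckFrom h′ w ∧ lastUpFollowedBy k w) ls) h
    ≡⟨ cong₂ _+_ (cong₂ _+_ (count-dyck L (suc h) k) (count-descent L (suc h) k)) (atPred-dyck h) ⟩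
  paths h (suc L) k ∎
  where
  open ≡-Reasoning
  ls : List (List Step)
  ls = listsOver UD L
  P : List Step → Bool
  P w = dyckFrom h w ∧ lastUpFollowedBy k w
  descent later : List Step → Bool
  descent w = dyckFrom (suc h) w ∧ (onlyDs w ∧ (length w ≡ᵇ k))
  later   w = dyckFrom (suc h) w ∧ lastUpFollowedBy k w
  afterU : ∀ w → P (U ∷ w) ≡ descent w ∨ later w
  afterU w rewrite dyckFrom-U h w = ∧-distribˡ-∨ (dyckFrom (suc h) w) _ _
  disjoint : ∀ w → descent w ≡ true → later w ≡ false
  disjoint w d =
    trans (cong (dyckFrom (suc h) w ∧_) (onlyDs⇒¬lastUpFollowedBy k w (∧≡true⇒ˡ (∧≡true⇒ʳ {dyckFrom (suc h) w} d))))
          (∧-zeroʳ _)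
  atPred-dyck : ∀ h → atPred (λ h′ → count (λ w → dyckFrom h′ w ∧ lastUpFollowedBy k w) ls) h
                      ≡ atPred (λ h′ → paths h′ L k) h
  atPred-dyck zero    = refl
  atPred-dyck (suc h) = count-dyck L h k

t′≡paths : ∀ n k → t′ n k ≡ paths 0 (n + n) k
t′≡paths n k = trans (count-filterᵇ (lastUpFollowedBy k) isDyck (listsOver UD (n + n))) (count-dyck (n + n) 0 k)

paths≥-split : ∀ L h k → paths≥ h L k ≡ paths h L k + paths≥ h L (suc k)
paths≥-split zero    h k = refl
paths≥-split (suc L) h k = begin
  paths≥ (suc h) L k + 𝟙 (c ∧ (k ≤ᵇ L)) + atPred (λ h′ → paths≥ h′ L k) h
    ≡⟨ cong₂ _+_ (cong₂ _+_ (paths≥-split L (suc h) k) (𝟙-∧-≤ᵇ-split c k L))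
                 (trans (atPred-cong (λ h′ → paths≥-split L h′ k) h) (atPred-+ _ _ h)) ⟩
  (p₁ + q₁) + (i + j) + (p₂ + q₂)
    ≡⟨ solve 6 (λ p₁ q₁ i j p₂ q₂ → (p₁ :+ q₁) :+ (i :+ j) :+ (p₂ :+ q₂) := (p₁ :+ i :+ p₂) :+ (q₁ :+ j :+ q₂))
             refl p₁ q₁ i j p₂ q₂ ⟩
  (p₁ + i + p₂) + (q₁ + j + q₂) ∎
  where
  open ≡-Reasoning
  c : Bool
  c  = L ≡ᵇ suc h
  p₁ q₁ i j p₂ q₂ : ℕ
  p₁ = paths (suc h) L k
  q₁ = paths≥ (suc h) L (suc k)
  i  = 𝟙 (c ∧ (L ≡ᵇ k))
  j  = 𝟙 (c ∧ (suc k ≤ᵇ L))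
  p₂ = atPred (λ h′ → paths h′ L k) h
  q₂ = atPred (λ h′ → paths≥ h′ L (suc k)) h

paths-length-1 : ∀ h k → paths h 1 k ≡ 0
paths-length-1 zero    k = refl
paths-length-1 (suc h) k = refl

lastPeak-indicators : ∀ L h k →
  𝟙 ((L ≡ᵇ suc h) ∧ (k ≤ᵇ suc h)) + 𝟙 ((suc L ≡ᵇ h) ∧ (suc L ≡ᵇ k)) + atPred (λ h′ → 𝟙 ((L ≡ᵇ h′) ∧ (k ≤ᵇ h′))) h
  ≡ 𝟙 ((L ≡ᵇ suc h) ∧ (k ≤ᵇ L)) + 𝟙 ((suc L ≡ᵇ h) ∧ (k ≤ᵇ h))
lastPeak-indicators L zero k with L ≡ᵇ 1 | ≡ᵇ-reflects-≡ L 1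
... | true  | ofʸ refl = +-identityʳ _
... | false | ofⁿ _    = refl
lastPeak-indicators L (suc h) k
  with L ≡ᵇ suc (suc h) | ≡ᵇ-reflects-≡ L (suc (suc h)) | L ≡ᵇ h | ≡ᵇ-reflects-≡ L h
... | true  | ofʸ refl | true  | ofʸ h+2≡h   = ⊥-elim (m≢1+n+m h (sym h+2≡h))
... | true  | ofʸ refl | false | ofⁿ _       = +-identityʳ _
... | false | ofⁿ _    | true  | ofʸ refl    =
  trans (sym (cong (𝟙 (suc L ≡ᵇ k) +_) (cong 𝟙 (≤ᵇ-suc k L)))) (sym (𝟙-≤ᵇ-split k (suc L)))
... | false | ofⁿ _    | false | ofⁿ _       = refl

-- Deleting the final peak U D leaves a path whose last up-step is followed by at least k steps, or
-- (the indicator) one without up-steps.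
paths-lastPeak : ∀ L h k → paths h (suc (suc L)) (suc k) ≡ paths≥ h L k + 𝟙 ((L ≡ᵇ h) ∧ (k ≤ᵇ h))
paths-lastPeak zero    zero    zero    = refl
paths-lastPeak zero    zero    (suc k) = refl
paths-lastPeak zero    (suc h) k       rewrite paths-length-1 (suc (suc h)) (suc k) | paths-length-1 h (suc k) = refl
paths-lastPeak (suc L) h       k       = begin
  paths (suc h) (suc (suc L)) (suc k) + u + atPred (λ h′ → paths h′ (suc (suc L)) (suc k)) h
    ≡⟨ cong₂ _+_ (cong (_+ u) (paths-lastPeak L (suc h) k))
                 (trans (atPred-cong (λ h′ → paths-lastPeak L h′ k) h) (atPred-+ _ _ h)) ⟩
  (G₁ + a) + u + (G₂ + c)
    ≡⟨ solve 5 (λ G₁ a u G₂ c → (G₁ :+ a) :+ u :+ (G₂ :+ c) := G₁ :+ G₂ :+ (a :+ u :+ c)) refl G₁ a u G₂ c ⟩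
  G₁ + G₂ + (a + u + c)
    ≡⟨ cong (G₁ + G₂ +_) (lastPeak-indicators L h k) ⟩
  G₁ + G₂ + (a′ + c′)
    ≡⟨ solve 4 (λ G₁ G₂ a′ c′ → G₁ :+ G₂ :+ (a′ :+ c′) := G₁ :+ a′ :+ G₂ :+ c′) refl G₁ G₂ a′ c′ ⟩
  G₁ + a′ + G₂ + c′ ∎
  where
  open ≡-Reasoning
  G₁ G₂ a u c a′ c′ : ℕ
  G₁ = paths≥ (suc h) L k
  G₂ = atPred (λ h′ → paths≥ h′ L k) h
  a  = 𝟙 ((L ≡ᵇ suc h) ∧ (k ≤ᵇ suc h))
  u  = 𝟙 ((suc L ≡ᵇ h) ∧ (suc L ≡ᵇ k))
  c  = atPred (λ h′ → 𝟙 ((L ≡ᵇ h′) ∧ (k ≤ᵇ h′))) h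
  a′ = 𝟙 ((L ≡ᵇ suc h) ∧ (k ≤ᵇ L))
  c′ = 𝟙 ((suc L ≡ᵇ h) ∧ (k ≤ᵇ h))

paths-zero : ∀ L h → paths h L 0 ≡ 0
paths-zero zero    h = refl
paths-zero (suc L) h rewrite paths-zero L (suc h) =
  cong₂ _+_ (cong 𝟙 (no-empty-descent L)) (trans (atPred-cong (λ h′ → paths-zero L h′) h) (atPred-zero h))
  where
  no-empty-descent : ∀ L → (L ≡ᵇ suc h) ∧ (L ≡ᵇ 0) ≡ false
  no-empty-descent zero    = refl
  no-empty-descent (suc L) = ∧-zeroʳ _
  atPred-zero : ∀ h → atPred (λ _ → 0) h ≡ 0
  atPred-zero zero    = refl
  atPred-zero (suc h) = refl

paths≥-vanish : ∀ L h k → L + h < k + k → paths≥ h L k ≡ 0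
paths≥-vanish zero    h k _  = refl
paths≥-vanish (suc L) h k lt =
  cong₂ _+_ (cong₂ _+_ (paths≥-vanish L (suc h) k L+h+1<2k) (cong 𝟙 no-peak)) (afterD h lt)
  where
  L+h+1<2k : L + suc h < k + k
  L+h+1<2k = subst (_< k + k) (sym (+-suc L h)) lt
  no-peak : (L ≡ᵇ suc h) ∧ (k ≤ᵇ L) ≡ false
  no-peak with L ≡ᵇ suc h | ≡ᵇ-reflects-≡ L (suc h) | k ≤ᵇ L | ≤ᵇ-reflects-≤ k L
  ... | true  | ofʸ refl | true  | ofʸ k≤L = ⊥-elim (<⇒≱ L+h+1<2k (+-mono-≤ k≤L k≤L))
  ... | true  | ofʸ _    | false | ofⁿ _   = refl
  ... | false | ofⁿ _    | _     | _       = refl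
  afterD : ∀ h → suc L + h < k + k → atPred (λ h′ → paths≥ h′ L k) h ≡ 0
  afterD zero    _  = refl
  afterD (suc h) lt = paths≥-vanish L h k (≤-<-trans (+-mono-≤ (n≤1+n L) (n≤1+n h)) lt)

t′≥ : ℕ → ℕ → ℕ
t′≥ n k = paths≥ 0 (n + n) k

t′-lastPeak : ∀ n k → t′ (suc (suc n)) (suc k) ≡ t′≥ (suc n) k
t′-lastPeak n k = begin
  t′ (suc (suc n)) (suc k)                         ≡⟨ t′≡paths (suc (suc n)) (suc k) ⟩
  paths 0 (suc (suc n) + suc (suc n)) (suc k)      ≡⟨ cong (λ L → paths 0 (suc (suc L)) (suc k)) (+-suc n (suc n)) ⟩
  paths 0 (suc (suc (suc n + suc n))) (suc k)      ≡⟨ paths-lastPeak (suc n + suc n) 0 k ⟩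
  t′≥ (suc n) k + 0                                ≡⟨ +-identityʳ _ ⟩
  t′≥ (suc n) k                                    ∎
  where open ≡-Reasoning

t′≥-split : ∀ n k → t′≥ n k ≡ t′ n k + t′≥ n (suc k)
t′≥-split n k = trans (paths≥-split (n + n) 0 k) (cong (_+ t′≥ n (suc k)) (sym (t′≡paths n k)))

t′-zero : ∀ n → t′ n 0 ≡ 0
t′-zero n = trans (t′≡paths n 0) (paths-zero (n + n) 0)

t′≥-vanish : ∀ n k → n < k → t′≥ n k ≡ 0
t′≥-vanish n k n<k = paths≥-vanish (n + n) 0 k (subst (_< k + k) (sym (+-identityʳ (n + n))) (+-mono-< n<k n<k))

t′-vanish : ∀ n k → n < k → t′ n k ≡ 0
t′-vanish n k n<k = m+n≡0⇒m≡0 (t′ n k) (trans (sym (t′≥-split n k)) (t′≥-vanish n k n<k))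

-- Subsequences and the pattern 1123

any-++ : (Q : A → Bool) (xs ys : List A) → any Q (xs ++ ys) ≡ any Q xs ∨ any Q ys
any-++ Q []       ys = refl
any-++ Q (x ∷ xs) ys = trans (cong (Q x ∨_) (any-++ Q xs ys)) (sym (∨-assoc (Q x) _ _))

any-map : {B : Set} (Q : B → Bool) (f : A → B) (xs : List A) → any Q (map f xs) ≡ any (λ x → Q (f x)) xs
any-map Q f []       = refl
any-map Q f (x ∷ xs) = cong (Q (f x) ∨_) (any-map Q f xs)

any-cong : {Q Q′ : A → Bool} → (∀ x → Q x ≡ Q′ x) → ∀ xs → any Q xs ≡ any Q′ xs
any-cong Q≗Q′ []       = refl
any-cong Q≗Q′ (x ∷ xs) = cong₂ _∨_ (Q≗Q′ x) (any-cong Q≗Q′ xs)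

any-∧ʳ : (Q : A → Bool) (b : Bool) (xs : List A) → any (λ x → Q x ∧ b) xs ≡ any Q xs ∧ b
any-∧ʳ Q b []       = refl
any-∧ʳ Q b (x ∷ xs) = trans (cong ((Q x ∧ b) ∨_) (any-∧ʳ Q b xs)) (sym (∧-distribʳ-∨ b (Q x) (any Q xs)))

anySubseq : (List A → Bool) → List A → Bool
anySubseq Q p = any Q (subseqs p)

anySubseq-cong : {Q Q′ : List A → Bool} → (∀ s → Q s ≡ Q′ s) → ∀ p → anySubseq Q p ≡ anySubseq Q′ p
anySubseq-cong Q≗Q′ p = any-cong Q≗Q′ (subseqs p)

anySubseq-∷ : (Q : List A → Bool) (x : A) (p : List A) →
              anySubseq Q (x ∷ p) ≡ anySubseq (λ s → Q (x ∷ s)) p ∨ anySubseq Q p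
anySubseq-∷ Q x p =
  trans (any-++ Q (map (x ∷_) (subseqs p)) (subseqs p)) (cong (_∨ anySubseq Q p) (any-map Q (x ∷_) (subseqs p)))

anySubseq-∷ʳ : (Q : List A → Bool) (p : List A) (y : A) →
               anySubseq Q (p ∷ʳ y) ≡ anySubseq Q p ∨ anySubseq (λ s → Q (s ∷ʳ y)) p
anySubseq-∷ʳ Q []      y = trans (∨-comm (Q (y ∷ [])) _) (cong ((Q [] ∨ false) ∨_) (sym (∨-identityʳ (Q (y ∷ [])))))
anySubseq-∷ʳ Q (x ∷ p) y = begin
  anySubseq Q (x ∷ (p ∷ʳ y))
    ≡⟨ anySubseq-∷ Q x (p ∷ʳ y) ⟩
  anySubseq (λ s → Q (x ∷ s)) (p ∷ʳ y) ∨ anySubseq Q (p ∷ʳ y)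
    ≡⟨ cong₂ _∨_ (anySubseq-∷ʳ (λ s → Q (x ∷ s)) p y) (anySubseq-∷ʳ Q p y) ⟩
  (anySubseq (λ s → Q (x ∷ s)) p ∨ anySubseq (λ s → Q (x ∷ (s ∷ʳ y))) p)
    ∨ (anySubseq Q p ∨ anySubseq (λ s → Q (s ∷ʳ y)) p)
    ≡⟨ ∨-interchange (anySubseq (λ s → Q (x ∷ s)) p) _ (anySubseq Q p) _ ⟩
  (anySubseq (λ s → Q (x ∷ s)) p ∨ anySubseq Q p)
    ∨ (anySubseq (λ s → Q (x ∷ (s ∷ʳ y))) p ∨ anySubseq (λ s → Q (s ∷ʳ y)) p)
    ≡⟨ cong₂ _∨_ (anySubseq-∷ Q x p) (anySubseq-∷ (λ s → Q (s ∷ʳ y)) x p) ⟨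
  anySubseq Q (x ∷ p) ∨ anySubseq (λ s → Q (s ∷ʳ y)) (x ∷ p) ∎
  where open ≡-Reasoning

anySubseq-null : (p : List A) → anySubseq null p ≡ true
anySubseq-null []      = refl
anySubseq-null (x ∷ p) =
  trans (anySubseq-∷ null x p) (trans (cong (anySubseq (λ s → null (x ∷ s)) p ∨_) (anySubseq-null p)) (∨-zeroʳ _))

anySubseq-++ : (Q : List A → Bool) (q w : List A) → anySubseq Q q ≡ true → anySubseq Q (q ++ w) ≡ true
anySubseq-++ Q q []      found = trans (cong (anySubseq Q) (++-identityʳ q)) found
anySubseq-++ Q q (y ∷ w) found =
  trans (cong (anySubseq Q) (sym (++-assoc q (y ∷ []) w)))
        (anySubseq-++ Q (q ∷ʳ y) w (trans (anySubseq-∷ʳ Q q y) (cong (_∨ anySubseq (λ s → Q (s ∷ʳ y)) q) found)))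

is1123 : List ℕ → Bool
is1123 (a ∷ b ∷ c ∷ d ∷ []) = (a ≡ᵇ b) ∧ ((a <ᵇ c) ∧ (c <ᵇ d))
is1123 _                    = false

orderIso-lengths : ∀ xs ys → length xs ≢ length ys → orderIso xs ys ≡ false
orderIso-lengths []       []       ≢ = ⊥-elim (≢ refl)
orderIso-lengths []       (y ∷ ys) _ = refl
orderIso-lengths (x ∷ xs) []       _ = refl
orderIso-lengths (x ∷ xs) (y ∷ ys) ≢ rewrite orderIso-lengths xs ys (≢ ∘ cong suc) = ∧-zeroʳ _

x∧[x∧false]≡false : ∀ x → x ∧ (x ∧ false) ≡ false
x∧[x∧false]≡false true  = refl
x∧[x∧false]≡false false = refl

orderIso-1123 : ∀ s → orderIso s (1 ∷ 1 ∷ 2 ∷ 3 ∷ []) ≡ is1123 s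
orderIso-1123 (a ∷ b ∷ c ∷ d ∷ []) with <-cmp a b
... | tri< a<b a≢b _ rewrite det (<ᵇ-reflects-< a b) (ofʸ a<b) | det (≡ᵇ-reflects-≡ a b) (ofⁿ a≢b) = refl
... | tri> b≮a a≢b b<a rewrite det (<ᵇ-reflects-< a b) (ofⁿ b≮a) | det (<ᵇ-reflects-< b a) (ofʸ b<a)
                             | det (≡ᵇ-reflects-≡ a b) (ofⁿ a≢b) = refl
... | tri≈ _ refl _ rewrite det (<ᵇ-reflects-< a a) (ofⁿ (n≮n a)) | det (≡ᵇ-reflects-≡ a a) (ofʸ refl)
  with <-cmp a c
...   | tri≈ _ refl _ rewrite det (<ᵇ-reflects-< a a) (ofⁿ (n≮n a)) = refl
...   | tri> a≮c _ _  rewrite det (<ᵇ-reflects-< a c) (ofⁿ a≮c) = refl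
...   | tri< a<c _ c≮a rewrite det (<ᵇ-reflects-< a c) (ofʸ a<c) | det (<ᵇ-reflects-< c a) (ofⁿ c≮a)
  with <-cmp c d
...     | tri< c<d _ d≮c rewrite det (<ᵇ-reflects-< c d) (ofʸ c<d) | det (<ᵇ-reflects-< d c) (ofⁿ d≮c)
                               | det (<ᵇ-reflects-< a d) (ofʸ (<-trans a<c c<d))
                               | det (<ᵇ-reflects-< d a) (ofⁿ (<-asym (<-trans a<c c<d))) = refl
-- c ≮ d falsifies the last comparison, and the rows of the two equal entries a coincide.
...     | tri≈ c≮d _ _ rewrite det (<ᵇ-reflects-< c d) (ofⁿ c≮d) =
  x∧[x∧false]≡false (((a <ᵇ d) == true ∧ (d <ᵇ a) == false) ∧ true)
...     | tri> c≮d _ _ rewrite det (<ᵇ-reflects-< c d) (ofⁿ c≮d) =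
  x∧[x∧false]≡false (((a <ᵇ d) == true ∧ (d <ᵇ a) == false) ∧ true)
orderIso-1123 []                        = refl
orderIso-1123 (a ∷ [])                  = refl
orderIso-1123 s@(_ ∷ _ ∷ [])            = orderIso-lengths s (1 ∷ 1 ∷ 2 ∷ 3 ∷ []) λ ()
orderIso-1123 s@(_ ∷ _ ∷ _ ∷ [])        = orderIso-lengths s (1 ∷ 1 ∷ 2 ∷ 3 ∷ []) λ ()
orderIso-1123 s@(_ ∷ _ ∷ _ ∷ _ ∷ _ ∷ _) = orderIso-lengths s (1 ∷ 1 ∷ 2 ∷ 3 ∷ []) λ ()

is112Below : ℕ → List ℕ → Bool
is112Below y (a ∷ b ∷ c ∷ []) = (a ≡ᵇ b) ∧ ((a <ᵇ c) ∧ (c <ᵇ y))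
is112Below y _                = false

is11Below : ℕ → List ℕ → Bool
is11Below z (a ∷ b ∷ []) = (a ≡ᵇ b) ∧ (a <ᵇ z)
is11Below z _            = false

isSingleton : ℕ → List ℕ → Bool
isSingleton x (a ∷ []) = a ≡ᵇ x
isSingleton x _        = false

is1123-∷ʳ : ∀ s y → is1123 (s ∷ʳ y) ≡ is112Below y s
is1123-∷ʳ []                        y = refl
is1123-∷ʳ (_ ∷ [])                  y = refl
is1123-∷ʳ (_ ∷ _ ∷ [])              y = refl
is1123-∷ʳ (_ ∷ _ ∷ _ ∷ [])          y = refl
is1123-∷ʳ (_ ∷ _ ∷ _ ∷ _ ∷ _ ∷ _)   y = refl
is1123-∷ʳ (_ ∷ _ ∷ _ ∷ _ ∷ [])      y = refl

is112Below-∷ʳ : ∀ s c y → is112Below y (s ∷ʳ c) ≡ is11Below c s ∧ (c <ᵇ y)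
is112Below-∷ʳ []                c y = refl
is112Below-∷ʳ (_ ∷ [])          c y = refl
is112Below-∷ʳ (a ∷ b ∷ [])      c y = sym (∧-assoc (a ≡ᵇ b) (a <ᵇ c) (c <ᵇ y))
is112Below-∷ʳ (_ ∷ _ ∷ _ ∷ [])     c y = refl
is112Below-∷ʳ (_ ∷ _ ∷ _ ∷ _ ∷ _) c y = refl

is11Below-∷ʳ : ∀ s b z → is11Below z (s ∷ʳ b) ≡ isSingleton b s ∧ (b <ᵇ z)
is11Below-∷ʳ []            b z = refl
is11Below-∷ʳ (a ∷ [])      b z with a ≡ᵇ b | ≡ᵇ-reflects-≡ a b
... | true  | ofʸ refl = refl
... | false | ofⁿ _    = refl
is11Below-∷ʳ (_ ∷ _ ∷ [])     b z = refl
is11Below-∷ʳ (_ ∷ _ ∷ _ ∷ _) b z = refl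

isSingleton-∷ʳ : ∀ s a x → isSingleton x (s ∷ʳ a) ≡ null s ∧ (a ≡ᵇ x)
isSingleton-∷ʳ []          a x = refl
isSingleton-∷ʳ (_ ∷ [])    a x = refl
isSingleton-∷ʳ (_ ∷ _ ∷ _) a x = refl

anySubseq-∷ʳ′ : {Q R : List A → Bool} (p : List A) (y : A) → (∀ s → Q (s ∷ʳ y) ≡ R s) →
                   anySubseq Q (p ∷ʳ y) ≡ anySubseq Q p ∨ anySubseq R p
anySubseq-∷ʳ′ {Q = Q} p y Q∷ʳ≗R = trans (anySubseq-∷ʳ Q p y) (cong (anySubseq Q p ∨_) (anySubseq-cong Q∷ʳ≗R p))

anySubseq-1123-∷ʳ : ∀ p y → anySubseq is1123 (p ∷ʳ y) ≡ anySubseq is1123 p ∨ anySubseq (is112Below y) p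
anySubseq-1123-∷ʳ p y = anySubseq-∷ʳ′ p y (λ s → is1123-∷ʳ s y)

anySubseq-112-∷ʳ : ∀ p c y →
  anySubseq (is112Below y) (p ∷ʳ c) ≡ anySubseq (is112Below y) p ∨ (anySubseq (is11Below c) p ∧ (c <ᵇ y))
anySubseq-112-∷ʳ p c y =
  trans (anySubseq-∷ʳ′ p c (λ s → is112Below-∷ʳ s c y)) (cong (_ ∨_) (any-∧ʳ (is11Below c) (c <ᵇ y) (subseqs p)))

anySubseq-11-∷ʳ : ∀ p b z →
  anySubseq (is11Below z) (p ∷ʳ b) ≡ anySubseq (is11Below z) p ∨ (anySubseq (isSingleton b) p ∧ (b <ᵇ z))
anySubseq-11-∷ʳ p b z =
  trans (anySubseq-∷ʳ′ p b (λ s → is11Below-∷ʳ s b z)) (cong (_ ∨_) (any-∧ʳ (isSingleton b) (b <ᵇ z) (subseqs p)))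

anySubseq-1-∷ʳ : ∀ p a x → anySubseq (isSingleton x) (p ∷ʳ a) ≡ anySubseq (isSingleton x) p ∨ (a ≡ᵇ x)
anySubseq-1-∷ʳ p a x =
  trans (anySubseq-∷ʳ′ p a (λ s → isSingleton-∷ʳ s a x))
        (cong (_ ∨_) (trans (any-∧ʳ null (a ≡ᵇ x) (subseqs p)) (cong (_∧ (a ≡ᵇ x)) (anySubseq-null p))))

-- An automaton reading 1123-avoiding partitions

lessThan : Maybe ℕ → ℕ → Bool
lessThan nothing  y = false
lessThan (just x) y = x <ᵇ y

insertMin : Maybe ℕ → ℕ → Maybe ℕ
insertMin nothing  y = just y
insertMin (just x) y = just (x ⊓ y)

-- For a prefix: its largest entry, its least entry occurring twice, and the least c occurring in
-- some a a c with a < c (see Summary); nothing stands for ∞.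
record State : Set where
  constructor state
  field
    maxEntry      : ℕ
    leastRepeated : Maybe ℕ
    least112Top   : Maybe ℕ

open State

-- A next entry above least112Top would complete a 1123.
bound : State → ℕ
bound (state m d nothing)  = suc m
bound (state m d (just c)) = c

allowed : State → ℕ → Bool
allowed s y = (1 ≤ᵇ y) ∧ (y ≤ᵇ bound s)

step : State → ℕ → State
step (state m d e) y =
  state (m ⊔ y) (if y ≤ᵇ m then insertMin d y else d) (if lessThan d y then insertMin e y else e)

accepts : State → List ℕ → Bool
accepts s []      = true
accepts s (y ∷ w) = allowed s y ∧ accepts (step s y) w

initial : State
initial = state 0 nothing nothing

record Summary (p : List ℕ) (s : State) : Set where
  field
    canonical : isCanonical p ≡ true
    avoiding  : anySubseq is1123 p ≡ false
    maximum   : maxEntry s ≡ foldl _⊔_ 0 p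
    occurs    : ∀ x → anySubseq (isSingleton x) p ≡ (1 ≤ᵇ x) ∧ (x ≤ᵇ maxEntry s)
    repeats   : ∀ z → anySubseq (is11Below z) p ≡ lessThan (leastRepeated s) z
    has112    : ∀ y → anySubseq (is112Below y) p ≡ lessThan (least112Top s) y
    top≤max   : MaybeAll.All (_≤ maxEntry s) (least112Top s)

open Summary

canonicalFrom-∷ʳ : ∀ k p y →
  canonicalFrom k (p ∷ʳ y) ≡ canonicalFrom k p ∧ (not (y ≡ᵇ 0) ∧ (y <ᵇ suc (suc (foldl _⊔_ k p))))
canonicalFrom-∷ʳ k []      y = cong (not (y ≡ᵇ 0) ∧_) (∧-identityʳ _)
canonicalFrom-∷ʳ k (x ∷ p) y rewrite canonicalFrom-∷ʳ (k ⊔ x) p y =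
  trans (cong (not (x ≡ᵇ 0) ∧_) (sym (∧-assoc (x <ᵇ suc (suc k)) _ _))) (sym (∧-assoc (not (x ≡ᵇ 0)) _ _))

allowed-spec : ∀ m d e y → MaybeAll.All (_≤ m) e →
  (not (y ≡ᵇ 0) ∧ (y <ᵇ suc (suc m))) ∧ not (lessThan e y) ≡ allowed (state m d e) y
allowed-spec m d nothing  zero    _ = refl
allowed-spec m d nothing  (suc y) _ = ∧-identityʳ _
allowed-spec m d (just x) zero    _ = refl
allowed-spec m d (just x) (suc y) (just x≤m) with y <ᵇ x | <ᵇ-reflects-< y x
... | true  | ofʸ y<x rewrite det (<ᵇ-reflects-< y (suc m)) (ofʸ (≤-trans y<x (≤-trans x≤m (n≤1+n m))))
                            | det (<ᵇ-reflects-< x (suc y)) (ofⁿ (<⇒≱ y<x ∘ ≤-pred)) = refl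
... | false | ofⁿ y≮x rewrite det (<ᵇ-reflects-< x (suc y)) (ofʸ (s≤s (≮⇒≥ y≮x))) = ∧-zeroʳ _

valid-∷ʳ : ∀ {p s} y → Summary p s →
  isCanonical (p ∷ʳ y) ∧ not (anySubseq is1123 (p ∷ʳ y)) ≡ allowed s y
valid-∷ʳ {p} y σ
  rewrite canonicalFrom-∷ʳ 0 p y | anySubseq-1123-∷ʳ p y | canonical σ | avoiding σ | has112 σ y | sym (maximum σ)
  = allowed-spec _ _ _ y (top≤max σ)

⊓-<ᵇ : ∀ x y z → ((x ⊓ y) <ᵇ z) ≡ (x <ᵇ z) ∨ (y <ᵇ z)
⊓-<ᵇ x y z with ≤-total x y
... | inj₁ x≤y rewrite m≤n⇒m⊓n≡m x≤y with x <ᵇ z | <ᵇ-reflects-< x z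
...   | true  | ofʸ _   = refl
...   | false | ofⁿ x≮z = sym (det (<ᵇ-reflects-< y z) (ofⁿ (x≮z ∘ ≤-<-trans x≤y)))
⊓-<ᵇ x y z | inj₂ y≤x rewrite m≥n⇒m⊓n≡n y≤x with y <ᵇ z | <ᵇ-reflects-< y z
...   | true  | ofʸ _   = sym (∨-zeroʳ _)
...   | false | ofⁿ y≮z rewrite det (<ᵇ-reflects-< x z) (ofⁿ (y≮z ∘ ≤-<-trans y≤x)) = refl

lessThan-insertMin : ∀ d y z → lessThan (insertMin d y) z ≡ lessThan d z ∨ (y <ᵇ z)
lessThan-insertMin nothing  y z = refl
lessThan-insertMin (just x) y z = ⊓-<ᵇ x y z

occurs-step : ∀ m x y → 1 ≤ y → y ≤ suc m →
  ((1 ≤ᵇ x) ∧ (x ≤ᵇ m)) ∨ (y ≡ᵇ x) ≡ (1 ≤ᵇ x) ∧ (x ≤ᵇ m ⊔ y)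
occurs-step m x y 1≤y y≤1+m with y ≡ᵇ x | ≡ᵇ-reflects-≡ y x
... | true  | ofʸ refl rewrite det (≤ᵇ-reflects-≤ 1 y) (ofʸ 1≤y) | det (≤ᵇ-reflects-≤ y (m ⊔ y)) (ofʸ (m≤n⊔m m y)) =
  ∨-zeroʳ _
... | false | ofⁿ y≢x with x ≤ᵇ m | ≤ᵇ-reflects-≤ x m
...   | true  | ofʸ x≤m rewrite det (≤ᵇ-reflects-≤ x (m ⊔ y)) (ofʸ (≤-trans x≤m (m≤m⊔n m y))) = ∨-identityʳ _
...   | false | ofⁿ x≰m
  rewrite det (≤ᵇ-reflects-≤ x (m ⊔ y)) (ofⁿ (<⇒≱ (⊔-lub (≰⇒> x≰m) (≤∧≢⇒< (≤-trans y≤1+m (≰⇒> x≰m)) y≢x))))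
  = ∨-identityʳ _

leastRepeated-step : ∀ s y z →
  lessThan (leastRepeated (step s y)) z ≡ lessThan (leastRepeated s) z ∨ ((y ≤ᵇ maxEntry s) ∧ (y <ᵇ z))
leastRepeated-step (state m d e) y z with y ≤ᵇ m
... | true  = lessThan-insertMin d y z
... | false = sym (∨-identityʳ _)

least112Top-step : ∀ s y c →
  lessThan (least112Top (step s y)) c ≡ lessThan (least112Top s) c ∨ (lessThan (leastRepeated s) y ∧ (y <ᵇ c))
least112Top-step (state m d e) y c with lessThan d y
... | true  = lessThan-insertMin e y c
... | false = sym (∨-identityʳ _)

top≤max-step : ∀ s y → MaybeAll.All (_≤ maxEntry s) (least112Top s) →
               MaybeAll.All (_≤ maxEntry (step s y)) (least112Top (step s y))
top≤max-step (state m d e) y e≤m with lessThan d y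
top≤max-step (state m d nothing)  y _          | true  = just (m≤n⊔m m y)
top≤max-step (state m d (just x)) y (just x≤m) | true  = just (≤-trans (m⊓n≤m x y) (≤-trans x≤m (m≤m⊔n m y)))
top≤max-step (state m d nothing)  y _          | false = nothing
top≤max-step (state m d (just x)) y (just x≤m) | false = just (≤-trans x≤m (m≤m⊔n m y))

bound≤1+max : ∀ s → MaybeAll.All (_≤ maxEntry s) (least112Top s) → bound s ≤ suc (maxEntry s)
bound≤1+max (state m d nothing)  _          = ≤-refl
bound≤1+max (state m d (just x)) (just x≤m) = ≤-trans x≤m (n≤1+n m)

occurs-∷ʳ : ∀ {p s} y → Summary p s → 1 ≤ y → y ≤ suc (maxEntry s) →
            ∀ x → anySubseq (isSingleton x) (p ∷ʳ y) ≡ (1 ≤ᵇ x) ∧ (x ≤ᵇ maxEntry (step s y))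
occurs-∷ʳ {p} {s} y σ 1≤y y≤1+max x = begin
  anySubseq (isSingleton x) (p ∷ʳ y)          ≡⟨ anySubseq-1-∷ʳ p y x ⟩
  anySubseq (isSingleton x) p ∨ (y ≡ᵇ x)      ≡⟨ cong (_∨ (y ≡ᵇ x)) (occurs σ x) ⟩
  ((1 ≤ᵇ x) ∧ (x ≤ᵇ maxEntry s)) ∨ (y ≡ᵇ x)   ≡⟨ occurs-step (maxEntry s) x y 1≤y y≤1+max ⟩
  (1 ≤ᵇ x) ∧ (x ≤ᵇ maxEntry s ⊔ y)            ∎
  where open ≡-Reasoning

repeats-∷ʳ : ∀ {p s} y → Summary p s → 1 ≤ y →
             ∀ z → anySubseq (is11Below z) (p ∷ʳ y) ≡ lessThan (leastRepeated (step s y)) z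
repeats-∷ʳ {p} {s} y σ 1≤y z = begin
  anySubseq (is11Below z) (p ∷ʳ y)
    ≡⟨ anySubseq-11-∷ʳ p y z ⟩
  anySubseq (is11Below z) p ∨ (anySubseq (isSingleton y) p ∧ (y <ᵇ z))
    ≡⟨ cong₂ (λ a b → a ∨ (b ∧ (y <ᵇ z))) (repeats σ z) (occurs σ y) ⟩
  lessThan (leastRepeated s) z ∨ (((1 ≤ᵇ y) ∧ (y ≤ᵇ maxEntry s)) ∧ (y <ᵇ z))
    ≡⟨ cong (λ b → lessThan (leastRepeated s) z ∨ ((b ∧ (y ≤ᵇ maxEntry s)) ∧ (y <ᵇ z)))
            (det (≤ᵇ-reflects-≤ 1 y) (ofʸ 1≤y)) ⟩
  lessThan (leastRepeated s) z ∨ ((y ≤ᵇ maxEntry s) ∧ (y <ᵇ z))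
    ≡⟨ leastRepeated-step s y z ⟨
  lessThan (leastRepeated (step s y)) z ∎
  where open ≡-Reasoning

has112-∷ʳ : ∀ {p s} y → Summary p s →
            ∀ c → anySubseq (is112Below c) (p ∷ʳ y) ≡ lessThan (least112Top (step s y)) c
has112-∷ʳ {p} {s} y σ c = begin
  anySubseq (is112Below c) (p ∷ʳ y)
    ≡⟨ anySubseq-112-∷ʳ p y c ⟩
  anySubseq (is112Below c) p ∨ (anySubseq (is11Below y) p ∧ (y <ᵇ c))
    ≡⟨ cong₂ (λ a b → a ∨ (b ∧ (y <ᵇ c))) (has112 σ c) (repeats σ y) ⟩
  lessThan (least112Top s) c ∨ (lessThan (leastRepeated s) y ∧ (y <ᵇ c))
    ≡⟨ least112Top-step s y c ⟨
  lessThan (least112Top (step s y)) c ∎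
  where open ≡-Reasoning

summary-∷ʳ : ∀ {p s} y → Summary p s → allowed s y ≡ true → Summary (p ∷ʳ y) (step s y)
summary-∷ʳ {p} {s} y σ ok = record
  { canonical = ∧≡true⇒ˡ valid
  ; avoiding  = not-injective (∧≡true⇒ʳ {isCanonical (p ∷ʳ y)} valid)
  ; maximum   = trans (cong (_⊔ y) (maximum σ)) (sym (foldl-∷ʳ _⊔_ 0 y p))
  ; occurs    = occurs-∷ʳ y σ 1≤y y≤1+max
  ; repeats   = repeats-∷ʳ y σ 1≤y
  ; has112    = has112-∷ʳ y σ
  ; top≤max   = top≤max-step s y (top≤max σ)
  }
  where
  valid : isCanonical (p ∷ʳ y) ∧ not (anySubseq is1123 (p ∷ʳ y)) ≡ true
  valid = trans (valid-∷ʳ y σ) ok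
  1≤y : 1 ≤ y
  1≤y = ≤ᵇ⇒≤ 1 y (≡true⇒T (∧≡true⇒ˡ ok))
  y≤1+max : y ≤ suc (maxEntry s)
  y≤1+max = ≤-trans (≤ᵇ⇒≤ y (bound s) (≡true⇒T (∧≡true⇒ʳ {1 ≤ᵇ y} ok))) (bound≤1+max s (top≤max σ))

canonicalFrom-++ : ∀ k q w → canonicalFrom k q ≡ false → canonicalFrom k (q ++ w) ≡ false
canonicalFrom-++ k (x ∷ q) w bad with not (x ≡ᵇ 0) | x <ᵇ suc (suc k)
... | false | _     = refl
... | true  | false = refl
... | true  | true  = canonicalFrom-++ (k ⊔ x) q w bad

invalid-++ : ∀ q w → isCanonical q ∧ not (anySubseq is1123 q) ≡ false →
             isCanonical (q ++ w) ∧ not (anySubseq is1123 (q ++ w)) ≡ false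
invalid-++ q w bad with isCanonical q in canon
... | false rewrite canonicalFrom-++ 0 q w canon = refl
... | true  rewrite anySubseq-++ is1123 q w (not-injective bad) = ∧-zeroʳ _

summary-[] : Summary [] initial
summary-[] = record
  { canonical = refl ; avoiding = refl ; maximum = refl
  ; occurs = λ { zero → refl ; (suc x) → refl } ; repeats = λ _ → refl ; has112 = λ _ → refl ; top≤max = nothing }

valid-++ : ∀ {p s} w → Summary p s → isCanonical (p ++ w) ∧ not (anySubseq is1123 (p ++ w)) ≡ accepts s w
valid-++ {p} [] σ rewrite ++-identityʳ p | canonical σ | avoiding σ = refl
valid-++ {p} {s} (y ∷ w) σ rewrite sym (++-assoc p (y ∷ []) w) with allowed s y in ok
... | true  = valid-++ w (summary-∷ʳ y σ ok)
... | false = invalid-++ (p ∷ʳ y) w (trans (valid-∷ʳ y σ) ok)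

accepts-initial : ∀ π → isCanonical π ∧ avoids π (1 ∷ 1 ∷ 2 ∷ 3 ∷ []) ≡ accepts initial π
accepts-initial π =
  trans (cong (λ b → isCanonical π ∧ not b) (anySubseq-cong orderIso-1123 π)) (valid-++ π summary-[])

-- Counting partitions by the states they reach

-- One state for each accepted word of length r.
reach : State → ℕ → List State
reach s zero    = s ∷ []
reach s (suc r) = concatMap (λ y → reach (step s y) r) (range 1 (bound s))

bound-step : ∀ s y → y ≤ bound s → bound (step s y) ≤ suc (bound s)
bound-step (state m d nothing)  y y≤ with lessThan d y
... | true  = ≤-trans y≤ (n≤1+n _)
... | false = s≤s (⊔-lub (n≤1+n m) y≤)
bound-step (state m d (just x)) y y≤ with lessThan d y
... | true  = ≤-trans (m⊓n≤m x y) (n≤1+n x)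
... | false = n≤1+n x

reach-All : (I : ℕ → State → Set) → (∀ {r s y} → I (suc r) s → 1 ≤ y → y ≤ bound s → I r (step s y)) →
            ∀ r s → I r s → All (I 0) (reach s r)
reach-All I preserved zero    s Is = Is ∷ []
reach-All I preserved (suc r) s Is =
  concat⁺ (map⁺ (All.map (λ {y} (1≤y , y<) → reach-All I preserved r (step s y) (preserved Is 1≤y (≤-pred y<)))
                         (All-range 1 (bound s))))

count-accepts-range : ∀ s (Q : List ℕ → Bool) N r → bound s ≤ N →
  count (λ w → accepts s w ∧ Q w) (listsOver (range 1 N) (suc r))
  ≡ sumBy (λ y → count (λ w → accepts (step s y) w ∧ Q (y ∷ w)) (listsOver (range 1 N) r)) (range 1 (bound s))
count-accepts-range s Q N r bound≤N = begin
  count (λ w → accepts s w ∧ Q w) (listsOver (range 1 N) (suc r))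
    ≡⟨ count-listsOver-suc _ (range 1 N) r ⟩
  sumBy (λ y → count (λ w → (allowed s y ∧ accepts (step s y) w) ∧ Q (y ∷ w)) words) (range 1 N)
    ≡⟨ sumBy-cong (λ y → trans (count-cong (λ w → ∧-assoc (allowed s y) _ (Q (y ∷ w))) words)
                                (count-∧ˡ (allowed s y) _ words)) (range 1 N) ⟩
  sumBy (λ y → 𝟙 (allowed s y) * count (λ w → accepts (step s y) w ∧ Q (y ∷ w)) words) (range 1 N)
    ≡⟨ sumBy-range-restrict (bound s) N _ bound≤N ⟩
  sumBy (λ y → count (λ w → accepts (step s y) w ∧ Q (y ∷ w)) words) (range 1 (bound s)) ∎
  where
  open ≡-Reasoning
  words : List (List ℕ)
  words = listsOver (range 1 N) r

count-lastIs : ∀ r s k N → bound s + r ≤ N →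
  count (λ w → accepts s w ∧ lastIs (suc k) w) (listsOver (range 1 N) (suc r))
  ≡ count (λ s′ → suc k ≤ᵇ bound s′) (reach s r)
count-lastIs zero s k N bound+0≤N = begin
  count (λ w → accepts s w ∧ lastIs (suc k) w) (listsOver (range 1 N) 1)
    ≡⟨ count-accepts-range s (lastIs (suc k)) N 0 (subst (_≤ N) (+-identityʳ (bound s)) bound+0≤N) ⟩
  sumBy (λ y → count (λ w → accepts (step s y) w ∧ lastIs (suc k) (y ∷ w)) ([] ∷ [])) (range 1 (bound s))
    ≡⟨ sumBy-cong (λ y → trans (count-∷ (λ w → accepts (step s y) w ∧ lastIs (suc k) (y ∷ w)) [] []) (+-identityʳ _))
                  (range 1 (bound s)) ⟩
  sumBy (λ y → 𝟙 (y ≡ᵇ suc k)) (range 1 (bound s))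
    ≡⟨ count≡sumBy _ (range 1 (bound s)) ⟨
  count (_≡ᵇ suc k) (range 1 (bound s))
    ≡⟨ count-≡ᵇ-range 1 k (bound s) ⟩
  𝟙 (suc k ≤ᵇ bound s)
    ≡⟨ trans (count-∷ (λ s′ → suc k ≤ᵇ bound s′) s []) (+-identityʳ _) ⟨
  count (λ s′ → suc k ≤ᵇ bound s′) (reach s 0) ∎
  where open ≡-Reasoning
count-lastIs (suc r) s k N bound+r+1≤N = begin
  count (λ w → accepts s w ∧ lastIs (suc k) w) (listsOver (range 1 N) (suc (suc r)))
    ≡⟨ count-accepts-range s (lastIs (suc k)) N (suc r) (≤-trans (m≤m+n (bound s) (suc r)) bound+r+1≤N) ⟩
  sumBy (λ y → count (λ w → accepts (step s y) w ∧ lastIs (suc k) (y ∷ w)) (listsOver (range 1 N) (suc r)))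
        (range 1 (bound s))
    ≡⟨ sumBy-cong-range 1 (bound s) (λ y _ y≤bound →
         trans (count-listsOver-suc-cong (λ _ _ → refl) (range 1 N) r)
               (count-lastIs r (step s y) k N (bound′ y (≤-pred y≤bound)))) ⟩
  sumBy (λ y → count (λ s′ → suc k ≤ᵇ bound s′) (reach (step s y) r)) (range 1 (bound s))
    ≡⟨ count-concatMap _ (λ y → reach (step s y) r) (range 1 (bound s)) ⟨
  count (λ s′ → suc k ≤ᵇ bound s′) (reach s (suc r)) ∎
  where
  open ≡-Reasoning
  bound′ : ∀ y → y ≤ bound s → bound (step s y) + r ≤ N
  bound′ y y≤bound = ≤-trans (+-monoˡ-≤ r (bound-step s y y≤bound)) (subst (_≤ N) (+-suc (bound s) r) bound+r+1≤N)

t≡count-reach : ∀ r k → t (suc r) (suc k) ≡ count (λ s → suc k ≤ᵇ bound s) (reach initial r)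
t≡count-reach r k = begin
  t (suc r) (suc k)
    ≡⟨ count-filterᵇ _ isCanonical words ⟩
  count (λ π → isCanonical π ∧ (avoids π (1 ∷ 1 ∷ 2 ∷ 3 ∷ []) ∧ lastIs (suc k) π)) words
    ≡⟨ count-cong (λ π → trans (sym (∧-assoc (isCanonical π) _ _)) (cong (_∧ lastIs (suc k) π) (accepts-initial π)))
                  words ⟩
  count (λ π → accepts initial π ∧ lastIs (suc k) π) words
    ≡⟨ cong (λ V → count (λ π → accepts initial π ∧ lastIs (suc k) π) (listsOver V (suc r))) (applyUpTo-suc (suc r)) ⟩
  count (λ π → accepts initial π ∧ lastIs (suc k) π) (listsOver (range 1 (suc r)) (suc r))
    ≡⟨ count-lastIs r initial k (suc r) ≤-refl ⟩
  count (λ s → suc k ≤ᵇ bound s) (reach initial r) ∎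
  where
  open ≡-Reasoning
  words : List (List ℕ)
  words = listsOver (applyUpTo suc (suc r)) (suc r)

canonical⇒¬lastIs0 : ∀ m π → canonicalFrom m π ≡ true → lastIs 0 π ≡ false
canonical⇒¬lastIs0 m []           _     = refl
canonical⇒¬lastIs0 m (suc x ∷ []) _     = refl
canonical⇒¬lastIs0 m (x ∷ y ∷ π)  canon =
  canonical⇒¬lastIs0 (m ⊔ x) (y ∷ π) (∧≡true⇒ʳ {x <ᵇ suc (suc m)} (∧≡true⇒ʳ {not (x ≡ᵇ 0)} canon))

t-zero : ∀ n → t n 0 ≡ 0
t-zero n = trans (count-filterᵇ _ isCanonical words) (count-none _ ¬ends-in-0 words)
  where
  words : List (List ℕ)
  words = listsOver (applyUpTo suc n) n
  ¬ends-in-0 : ∀ π → isCanonical π ∧ (avoids π (1 ∷ 1 ∷ 2 ∷ 3 ∷ []) ∧ lastIs 0 π) ≡ false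
  ¬ends-in-0 π with isCanonical π in canon
  ... | false = refl
  ... | true  rewrite canonical⇒¬lastIs0 0 π canon = ∧-zeroʳ _

-- Raising a partition

oneRepeated : State → Bool
oneRepeated s = lessThan (leastRepeated s) 2

-- If s summarises p, then raise s summarises 1 followed by p with every entry increased by one.
raise : State → State
raise (state m d e) = state (suc m) (Maybe.map suc d) (Maybe.map suc e)

WellFormed : State → Set
WellFormed (state m d e) = 1 ≤ m × MaybeAll.All (1 ≤_) d × MaybeAll.All (2 ≤_) e

bound-raise : ∀ s → bound (raise s) ≡ suc (bound s)
bound-raise (state m d nothing)  = refl
bound-raise (state m d (just x)) = refl

lessThan-raise : ∀ d y → lessThan (Maybe.map suc d) (suc y) ≡ lessThan d y
lessThan-raise nothing  y = refl
lessThan-raise (just x) y = refl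

insertMin-raise : ∀ d y → insertMin (Maybe.map suc d) (suc y) ≡ Maybe.map suc (insertMin d y)
insertMin-raise nothing  y = refl
insertMin-raise (just x) y = refl

step-raise : ∀ s y → step (raise s) (suc y) ≡ raise (step s y)
step-raise (state m d e) y rewrite ≤ᵇ-suc y m | lessThan-raise d y with y ≤ᵇ m | lessThan d y
... | true  | true  = cong₂ (state (suc (m ⊔ y))) (insertMin-raise d y) (insertMin-raise e y)
... | true  | false = cong (λ d′ → state (suc (m ⊔ y)) d′ (Maybe.map suc e)) (insertMin-raise d y)
... | false | true  = cong (state (suc (m ⊔ y)) (Maybe.map suc d)) (insertMin-raise e y)
... | false | false = refl

oneRepeated-raise : ∀ s → MaybeAll.All (1 ≤_) (leastRepeated s) → oneRepeated (raise s) ≡ false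
oneRepeated-raise (state m nothing  e) _               = refl
oneRepeated-raise (state m (just x) e) (just (s≤s _)) = refl

oneRepeated-step : ∀ s y → oneRepeated (step s y) ≡ oneRepeated s ∨ ((y ≤ᵇ maxEntry s) ∧ (y <ᵇ 2))
oneRepeated-step s y = leastRepeated-step s y 2

oneRepeated-step-1 : ∀ s → 1 ≤ maxEntry s → oneRepeated (step s 1) ≡ true
oneRepeated-step-1 s 1≤m rewrite oneRepeated-step s 1 | det (≤ᵇ-reflects-≤ 1 (maxEntry s)) (ofʸ 1≤m) = ∨-zeroʳ _

oneRepeated-step-≥2 : ∀ s y → 2 ≤ y → oneRepeated (step s y) ≡ oneRepeated s
oneRepeated-step-≥2 s y 2≤y rewrite oneRepeated-step s y | det (<ᵇ-reflects-< y 2) (ofⁿ (<⇒≱ 2≤y ∘ ≤-pred))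
  = trans (cong (oneRepeated s ∨_) (∧-zeroʳ _)) (∨-identityʳ _)

oneRepeated-preserved : ∀ s y → oneRepeated s ≡ true → oneRepeated (step s y) ≡ true
oneRepeated-preserved s y rep rewrite oneRepeated-step s y | rep = refl

insertMin-All : ∀ {P : ℕ → Set} {d y} → MaybeAll.All P d → P y → (∀ {x} → P x → P y → P (x ⊓ y)) →
                MaybeAll.All P (insertMin d y)
insertMin-All nothing    Py _  = just Py
insertMin-All (just Px) Py ⊓P = just (⊓P Px Py)

lessThan⇒2≤ : ∀ {d y} → lessThan d y ≡ true → MaybeAll.All (1 ≤_) d → 2 ≤ y
lessThan⇒2≤ {just x} {y} x<y (just 1≤x) = ≤-trans (s≤s 1≤x) (<ᵇ⇒< x y (≡true⇒T x<y))

lessThan-mono : ∀ d {y z} → lessThan d y ≡ true → y ≤ z → lessThan d z ≡ true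
lessThan-mono (just x) {y} {z} x<y y≤z = det (<ᵇ-reflects-< x z) (ofʸ (<-≤-trans (<ᵇ⇒< x y (≡true⇒T x<y)) y≤z))

leastRepeated-positive-step : ∀ s y → MaybeAll.All (1 ≤_) (leastRepeated s) → 1 ≤ y →
                              MaybeAll.All (1 ≤_) (leastRepeated (step s y))
leastRepeated-positive-step (state m d e) y d≥1 1≤y with y ≤ᵇ m
... | true  = insertMin-All d≥1 1≤y ⊓-glb
... | false = d≥1

WellFormed-step : ∀ {s y} → WellFormed s → 1 ≤ y → WellFormed (step s y)
WellFormed-step {s@(state m d e)} {y} (1≤m , d≥1 , e≥2) 1≤y =
  ≤-trans 1≤m (m≤m⊔n m y) , leastRepeated-positive-step s y d≥1 1≤y , e′≥2
  where
  e′≥2 : MaybeAll.All (2 ≤_) (if lessThan d y then insertMin e y else e)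
  e′≥2 with lessThan d y in d<y
  ... | true  = insertMin-All e≥2 (lessThan⇒2≤ d<y d≥1) ⊓-glb
  ... | false = e≥2

2≤bound : ∀ s → WellFormed s → 2 ≤ bound s
2≤bound (state m d nothing)  (1≤m , _ , _)        = s≤s 1≤m
2≤bound (state m d (just x)) (_   , _ , just 2≤x) = 2≤x

≤2⇒≤ᵇbound : ∀ {ℓ} s → ℓ ≤ 2 → WellFormed s → (ℓ ≤ᵇ bound s) ≡ true
≤2⇒≤ᵇbound {ℓ} s ℓ≤2 ws = det (≤ᵇ-reflects-≤ ℓ (bound s)) (ofʸ (≤-trans ℓ≤2 (2≤bound s ws)))

¬lessThan-1 : ∀ {d} → MaybeAll.All (1 ≤_) d → lessThan d 1 ≡ false
¬lessThan-1 nothing           = refl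
¬lessThan-1 (just (s≤s z≤n)) = refl

bound-step-1 : ∀ s → WellFormed s → bound (step s 1) ≡ bound s
bound-step-1 (state m d e) (1≤m , d≥1 , _) rewrite m≥n⇒m⊔n≡m 1≤m | ¬lessThan-1 d≥1 with e
... | nothing = refl
... | just x  = refl

bound-step-112 : ∀ s y → lessThan (leastRepeated s) y ≡ true → y ≤ bound s → bound (step s y) ≡ y
bound-step-112 (state m d e) y d<y y≤bound rewrite d<y with e
... | nothing = refl
... | just x  = m≥n⇒m⊓n≡n y≤bound

reach-oneRepeated : ∀ r s → oneRepeated s ≡ true → All (λ s′ → oneRepeated s′ ≡ true) (reach s r)
reach-oneRepeated r s =
  reach-All (λ _ s → oneRepeated s ≡ true) (λ {r s y} rep _ _ → oneRepeated-preserved s y rep) r s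

reach-WellFormed : ∀ r s → WellFormed s → All WellFormed (reach s r)
reach-WellFormed r s = reach-All (λ _ → WellFormed) (λ ws 1≤y _ → WellFormed-step ws 1≤y) r s

reach-bound : ∀ N r s → bound s + r ≤ N → All (λ s′ → bound s′ ≤ N) (reach s r)
reach-bound N r s b =
  All.map (λ {s′} → subst (_≤ N) (+-identityʳ (bound s′)))
          (reach-All (λ r s → bound s + r ≤ N) (λ {r} {s} {y} → preserved {r} {s} {y}) r s b)
  where
  preserved : ∀ {r s y} → bound s + suc r ≤ N → 1 ≤ y → y ≤ bound s → bound (step s y) + r ≤ N
  preserved {r} {s} {y} b _ y≤bound =
    ≤-trans (+-monoˡ-≤ r (bound-step s y y≤bound)) (subst (_≤ N) (+-suc (bound s) r) b)

sumBy-reach-raise : ∀ (f : State → ℕ) r s → MaybeAll.All (1 ≤_) (leastRepeated s) →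
  sumBy (λ s′ → 𝟙 (not (oneRepeated s′)) * f s′) (reach (raise s) r) ≡ sumBy (f ∘ raise) (reach s r)
sumBy-reach-raise f zero    s d≥1 rewrite oneRepeated-raise s d≥1 = cong (_+ 0) (+-identityʳ (f (raise s)))
sumBy-reach-raise f (suc r) s d≥1 = begin
  sumBy F (concatMap (λ y → reach (step (raise s) y) r) (range 1 (bound (raise s))))
    ≡⟨ sumBy-concatMap F _ (range 1 (bound (raise s))) ⟩
  sumBy (λ y → sumBy F (reach (step (raise s) y) r)) (range 1 (bound (raise s)))
    ≡⟨ cong (λ L → sumBy (λ y → sumBy F (reach (step (raise s) y) r)) (range 1 L)) (bound-raise s) ⟩
  sumBy F (reach (step (raise s) 1) r) + sumBy (λ y → sumBy F (reach (step (raise s) y) r)) (range 2 (bound s))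
    ≡⟨ cong₂ _+_ oneRepeated-after-1 (cong (sumBy _) (range-suc 1 (bound s))) ⟩
  0 + sumBy (λ y → sumBy F (reach (step (raise s) y) r)) (map suc (range 1 (bound s)))
    ≡⟨ sumBy-map _ suc (range 1 (bound s)) ⟩
  sumBy (λ y → sumBy F (reach (step (raise s) (suc y)) r)) (range 1 (bound s))
    ≡⟨ sumBy-cong-range 1 (bound s) (λ y 1≤y _ →
         trans (cong (λ s′ → sumBy F (reach s′ r)) (step-raise s y))
               (sumBy-reach-raise f r (step s y) (leastRepeated-positive-step s y d≥1 1≤y))) ⟩
  sumBy (λ y → sumBy (f ∘ raise) (reach (step s y) r)) (range 1 (bound s))
    ≡⟨ sumBy-concatMap (f ∘ raise) (λ y → reach (step s y) r) (range 1 (bound s)) ⟨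
  sumBy (f ∘ raise) (reach s (suc r)) ∎
  where
  open ≡-Reasoning
  F : State → ℕ
  F s′ = 𝟙 (not (oneRepeated s′)) * f s′
  oneRepeated-after-1 : sumBy F (reach (step (raise s) 1) r) ≡ 0
  oneRepeated-after-1 =
    trans (sumBy-cong-All (All.map (λ {s′} rep → cong (λ b → 𝟙 (not b) * f s′) rep)
                                   (reach-oneRepeated r _ (oneRepeated-step-1 (raise s) (s≤s z≤n)))))
          (sumBy-zero (reach (step (raise s) 1) r))

sumBy-reach-suc : ∀ (f : State → ℕ) r s → sumBy f (reach s (suc r)) ≡ sumBy (λ s′ → sumBy f (reach s′ 1)) (reach s r)
sumBy-reach-suc f zero    s = sym (+-identityʳ _)
sumBy-reach-suc f (suc r) s =
  trans (sumBy-concatMap f (λ y → reach (step s y) (suc r)) (range 1 (bound s)))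
        (trans (sumBy-cong (λ y → sumBy-reach-suc f r (step s y)) (range 1 (bound s)))
               (sym (sumBy-concatMap _ (λ y → reach (step s y) r) (range 1 (bound s)))))

reach-1 : ∀ s → reach s 1 ≡ map (step s) (range 1 (bound s))
reach-1 s = trans (sym (concatMap-map [_] (step s) (range 1 (bound s)))) (concatMap-pure _)

reach-initial-suc : ∀ n → reach initial (suc n) ≡ reach (raise initial) n
reach-initial-suc n = ++-identityʳ _

-- Appending 1 makes 1 repeated and keeps the bound. Appending y ≥ 2 leaves oneRepeated unchanged;
-- if 1 is repeated, it creates 1 1 y and so makes the bound y.
count-successors : ∀ s ℓ → WellFormed s →
  count (λ s′ → oneRepeated s′ ∧ (suc (suc ℓ) ≤ᵇ bound s′)) (reach s 1)
  ≡ 𝟙 (suc (suc ℓ) ≤ᵇ bound s) + 𝟙 (oneRepeated s) * (bound s ∸ suc ℓ)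
count-successors s ℓ ws rewrite reach-1 s with bound s in bound≡ | 2≤bound s ws
... | suc L | s≤s _ = begin
  count P (step s 1 ∷ map (step s) (range 2 L))
    ≡⟨ count-∷ P (step s 1) _ ⟩
  𝟙 (P (step s 1)) + count P (map (step s) (range 2 L))
    ≡⟨ cong₂ _+_ (cong 𝟙 first) (trans (count-map P (step s) (range 2 L)) rest) ⟩
  𝟙 (suc (suc ℓ) ≤ᵇ suc L) + 𝟙 (oneRepeated s) * (L ∸ ℓ) ∎
  where
  open ≡-Reasoning
  P : State → Bool
  P s′ = oneRepeated s′ ∧ (suc (suc ℓ) ≤ᵇ bound s′)
  first : P (step s 1) ≡ (suc (suc ℓ) ≤ᵇ suc L)
  first = cong₂ _∧_ (oneRepeated-step-1 s (proj₁ ws)) (cong (suc (suc ℓ) ≤ᵇ_) (trans (bound-step-1 s ws) bound≡))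
  rest : count (P ∘ step s) (range 2 L) ≡ 𝟙 (oneRepeated s) * (L ∸ ℓ)
  rest with oneRepeated s in rep
  ... | true  =
    trans (count-cong-All (All.map new112 (All-range 2 L))) (trans (count-≤ᵇ-range 2 ℓ L) (sym (+-identityʳ _)))
    where
    new112 : ∀ {y} → 2 ≤ y × y < 2 + L → P (step s y) ≡ (2 + ℓ ≤ᵇ y)
    new112 {y} (2≤y , y<2+L) rewrite oneRepeated-preserved s y rep =
      cong (2 + ℓ ≤ᵇ_)
           (bound-step-112 s y (lessThan-mono (leastRepeated s) rep 2≤y) (subst (y ≤_) (sym bound≡) (≤-pred y<2+L)))
  ... | false = trans (count-cong-All (All.map unchanged (All-range 2 L))) (count-none _ (λ _ → refl) (range 2 L))
    where
    unchanged : ∀ {y} → 2 ≤ y × y < 2 + L → P (step s y) ≡ false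
    unchanged {y} (2≤y , _) rewrite oneRepeated-step-≥2 s y 2≤y | rep = refl

-- Recurrences

admitting : ℕ → ℕ → ℕ
admitting n ℓ = count (λ s → ℓ ≤ᵇ bound s) (reach initial n)

admitting₁ : ℕ → ℕ → ℕ
admitting₁ n ℓ = count (λ s → oneRepeated s ∧ (ℓ ≤ᵇ bound s)) (reach initial n)

slack₁ : ℕ → ℕ → ℕ
slack₁ n ℓ = sumBy (λ s → 𝟙 (oneRepeated s) * (bound s ∸ suc ℓ)) (reach initial n)

reach-initial-WellFormed : ∀ n → All WellFormed (reach initial (suc n))
reach-initial-WellFormed n =
  subst (All WellFormed) (sym (reach-initial-suc n))
        (reach-WellFormed n (raise initial) (s≤s z≤n , nothing , nothing))

admitting-suc : ∀ n ℓ → admitting (suc n) (suc ℓ) ≡ admitting n ℓ + admitting₁ (suc n) (suc ℓ)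
admitting-suc n ℓ = begin
  count P S
    ≡⟨ count≡sumBy P S ⟩
  sumBy (λ s → 𝟙 (P s)) S
    ≡⟨ sumBy-cong (λ s → 𝟙-split (oneRepeated s) (P s)) S ⟩
  sumBy (λ s → 𝟙 (not (oneRepeated s)) * 𝟙 (P s) + 𝟙 (oneRepeated s ∧ P s)) S
    ≡⟨ sumBy-+ _ _ S ⟩
  sumBy (λ s → 𝟙 (not (oneRepeated s)) * 𝟙 (P s)) S + sumBy (λ s → 𝟙 (oneRepeated s ∧ P s)) S
    ≡⟨ cong₂ _+_ (trans (cong (sumBy _) (reach-initial-suc n)) (sumBy-reach-raise (λ s → 𝟙 (P s)) n initial nothing))
                 (sym (count≡sumBy _ S)) ⟩
  sumBy (λ s → 𝟙 (P (raise s))) (reach initial n) + admitting₁ (suc n) (suc ℓ)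
    ≡⟨ cong (_+ admitting₁ (suc n) (suc ℓ))
            (trans (sumBy-cong (λ s → cong 𝟙 (raised s)) (reach initial n)) (sym (count≡sumBy _ (reach initial n)))) ⟩
  admitting n ℓ + admitting₁ (suc n) (suc ℓ) ∎
  where
  open ≡-Reasoning
  S : List State
  S = reach initial (suc n)
  P : State → Bool
  P s = suc ℓ ≤ᵇ bound s
  raised : ∀ s → P (raise s) ≡ (ℓ ≤ᵇ bound s)
  raised s = trans (cong (suc ℓ ≤ᵇ_) (bound-raise s)) (≤ᵇ-suc ℓ (bound s))

admitting₁-suc : ∀ n ℓ → admitting₁ (suc (suc n)) (suc (suc ℓ)) ≡ admitting (suc n) (suc (suc ℓ)) + slack₁ (suc n) ℓ
admitting₁-suc n ℓ = begin
  count P (reach initial (suc (suc n)))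
    ≡⟨ count≡sumBy P (reach initial (suc (suc n))) ⟩
  sumBy (λ s → 𝟙 (P s)) (reach initial (suc (suc n)))
    ≡⟨ sumBy-reach-suc _ (suc n) initial ⟩
  sumBy (λ s → sumBy (λ s′ → 𝟙 (P s′)) (reach s 1)) (reach initial (suc n))
    ≡⟨ sumBy-cong-All (All.map (λ {s} ws → trans (sym (count≡sumBy P (reach s 1))) (count-successors s ℓ ws))
                               (reach-initial-WellFormed n)) ⟩
  sumBy (λ s → 𝟙 (suc (suc ℓ) ≤ᵇ bound s) + 𝟙 (oneRepeated s) * (bound s ∸ suc ℓ)) (reach initial (suc n))
    ≡⟨ sumBy-+ _ _ (reach initial (suc n)) ⟩
  sumBy (λ s → 𝟙 (suc (suc ℓ) ≤ᵇ bound s)) (reach initial (suc n)) + slack₁ (suc n) ℓ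
    ≡⟨ cong (_+ slack₁ (suc n) ℓ) (sym (count≡sumBy _ (reach initial (suc n)))) ⟩
  admitting (suc n) (suc (suc ℓ)) + slack₁ (suc n) ℓ ∎
  where
  open ≡-Reasoning
  P : State → Bool
  P s = oneRepeated s ∧ (suc (suc ℓ) ≤ᵇ bound s)

slack₁-split : ∀ n ℓ → slack₁ n ℓ ≡ admitting₁ n (suc (suc ℓ)) + slack₁ n (suc ℓ)
slack₁-split n ℓ =
  trans (sumBy-cong split (reach initial n))
        (trans (sumBy-+ _ _ (reach initial n)) (cong (_+ slack₁ n (suc ℓ)) (sym (count≡sumBy _ (reach initial n)))))
  where
  split : ∀ s → 𝟙 (oneRepeated s) * (bound s ∸ suc ℓ)
              ≡ 𝟙 (oneRepeated s ∧ (suc (suc ℓ) ≤ᵇ bound s)) + 𝟙 (oneRepeated s) * (bound s ∸ suc (suc ℓ))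
  split s with oneRepeated s
  ... | false = refl
  ... | true  = trans (+-identityʳ _)
                      (trans (∸-split (bound s) (suc ℓ)) (cong (𝟙 (suc (suc ℓ) ≤ᵇ bound s) +_) (sym (+-identityʳ _))))

slack₁-vanish : ∀ n ℓ → n ≤ ℓ → slack₁ n ℓ ≡ 0
slack₁-vanish n ℓ n≤ℓ =
  trans (sumBy-cong-All (All.map (λ {s} → no-slack {s}) (reach-bound (suc n) n initial ≤-refl)))
        (sumBy-zero (reach initial n))
  where
  no-slack : ∀ {s} → bound s ≤ suc n → 𝟙 (oneRepeated s) * (bound s ∸ suc ℓ) ≡ 0
  no-slack {s} b rewrite m≤n⇒m∸n≡0 (≤-trans b (s≤s n≤ℓ)) = *-zeroʳ (𝟙 (oneRepeated s))

admitting-0 : ∀ n → admitting n 0 ≡ admitting n 1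
admitting-0 zero    = refl
admitting-0 (suc n) =
  count-cong-All (All.map (λ {s} ws → sym (≤2⇒≤ᵇbound s (s≤s z≤n) ws)) (reach-initial-WellFormed n))

admitting₁-1 : ∀ n → admitting₁ (suc n) 1 ≡ admitting₁ (suc n) 2
admitting₁-1 n = count-cong-All (All.map bound≥1≡bound≥2 (reach-initial-WellFormed n))
  where
  bound≥1≡bound≥2 : ∀ {s} → WellFormed s → oneRepeated s ∧ (1 ≤ᵇ bound s) ≡ oneRepeated s ∧ (2 ≤ᵇ bound s)
  bound≥1≡bound≥2 {s} ws = cong (oneRepeated s ∧_) (trans (≤2⇒≤ᵇbound s (s≤s z≤n) ws) (sym (≤2⇒≤ᵇbound s ≤-refl ws)))

Agree : ℕ → Set
Agree n = (∀ ℓ → admitting n (suc ℓ) ≡ t′ (suc n) (suc ℓ))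
        × (∀ ℓ → admitting₁ (suc n) (suc (suc ℓ)) ≡ t′ (suc (suc n)) (suc (suc (suc ℓ))))

slack₁-agrees : ∀ n → (∀ ℓ → admitting₁ (suc n) (suc (suc ℓ)) ≡ t′ (suc (suc n)) (suc (suc (suc ℓ)))) →
                ∀ ℓ → slack₁ (suc n) ℓ ≡ t′≥ (suc (suc n)) (suc (suc (suc ℓ)))
slack₁-agrees n agree₁ ℓ = downward (suc n) ℓ (m≤m+n (suc n) ℓ)
  where
  -- Downward induction on ℓ, from the values ℓ ≥ suc n where slack₁ (suc n) ℓ vanishes.
  downward : ∀ c ℓ → suc n ≤ c + ℓ → slack₁ (suc n) ℓ ≡ t′≥ (suc (suc n)) (suc (suc (suc ℓ)))
  downward zero    ℓ n<ℓ =
    trans (slack₁-vanish (suc n) ℓ n<ℓ) (sym (t′≥-vanish (suc (suc n)) _ (s≤s (s≤s (s≤s (≤-trans (n≤1+n n) n<ℓ))))))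
  downward (suc c) ℓ n<c+ℓ = begin
    slack₁ (suc n) ℓ
      ≡⟨ slack₁-split (suc n) ℓ ⟩
    admitting₁ (suc n) (suc (suc ℓ)) + slack₁ (suc n) (suc ℓ)
      ≡⟨ cong₂ _+_ (agree₁ ℓ) (downward c (suc ℓ) (subst (suc n ≤_) (sym (+-suc c ℓ)) n<c+ℓ)) ⟩
    t′ (suc (suc n)) (suc (suc (suc ℓ))) + t′≥ (suc (suc n)) (suc (suc (suc (suc ℓ))))
      ≡⟨ t′≥-split (suc (suc n)) (suc (suc (suc ℓ))) ⟨
    t′≥ (suc (suc n)) (suc (suc (suc ℓ))) ∎
    where open ≡-Reasoning

agree-0 : Agree 0
agree-0 = (λ { zero → refl ; (suc ℓ) → refl }) , λ ℓ → sym (t′-vanish 2 (suc (suc (suc ℓ))) (s≤s (s≤s (s≤s z≤n))))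

admitting-agrees : ∀ n → Agree n → ∀ ℓ → admitting (suc n) (suc ℓ) ≡ t′ (suc (suc n)) (suc ℓ)
admitting-agrees n (agree , agree₁) zero = begin
  admitting (suc n) 1
    ≡⟨ admitting-suc n 0 ⟩
  admitting n 0 + admitting₁ (suc n) 1
    ≡⟨ cong₂ _+_ (trans (admitting-0 n) (agree 0)) (trans (admitting₁-1 n) (agree₁ 0)) ⟩
  t′ (suc n) 1 + t′ (suc (suc n)) 3
    ≡⟨ cong (t′ (suc n) 1 +_) (t′-lastPeak n 2) ⟩
  t′ (suc n) 1 + t′≥ (suc n) 2
    ≡⟨ t′≥-split (suc n) 1 ⟨
  t′≥ (suc n) 1
    ≡⟨ cong (_+ t′≥ (suc n) 1) (t′-zero (suc n)) ⟨
  t′ (suc n) 0 + t′≥ (suc n) 1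
    ≡⟨ t′≥-split (suc n) 0 ⟨
  t′≥ (suc n) 0
    ≡⟨ t′-lastPeak n 0 ⟨
  t′ (suc (suc n)) 1 ∎
  where open ≡-Reasoning
admitting-agrees n (agree , agree₁) (suc ℓ) = begin
  admitting (suc n) (suc (suc ℓ))
    ≡⟨ admitting-suc n (suc ℓ) ⟩
  admitting n (suc ℓ) + admitting₁ (suc n) (suc (suc ℓ))
    ≡⟨ cong₂ _+_ (agree ℓ) (agree₁ ℓ) ⟩
  t′ (suc n) (suc ℓ) + t′ (suc (suc n)) (suc (suc (suc ℓ)))
    ≡⟨ cong (t′ (suc n) (suc ℓ) +_) (t′-lastPeak n (suc (suc ℓ))) ⟩
  t′ (suc n) (suc ℓ) + t′≥ (suc n) (suc (suc ℓ))
    ≡⟨ t′≥-split (suc n) (suc ℓ) ⟨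
  t′≥ (suc n) (suc ℓ)
    ≡⟨ t′-lastPeak n (suc ℓ) ⟨
  t′ (suc (suc n)) (suc (suc ℓ)) ∎
  where open ≡-Reasoning

admitting₁-agrees : ∀ n → Agree n →
                    ∀ ℓ → admitting₁ (suc (suc n)) (suc (suc ℓ)) ≡ t′ (suc (suc (suc n))) (suc (suc (suc ℓ)))
admitting₁-agrees n ag@(_ , agree₁) ℓ = begin
  admitting₁ (suc (suc n)) (suc (suc ℓ))
    ≡⟨ admitting₁-suc n ℓ ⟩
  admitting (suc n) (suc (suc ℓ)) + slack₁ (suc n) ℓ
    ≡⟨ cong₂ _+_ (admitting-agrees n ag (suc ℓ)) (slack₁-agrees n agree₁ ℓ) ⟩
  t′ (suc (suc n)) (suc (suc ℓ)) + t′≥ (suc (suc n)) (suc (suc (suc ℓ)))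
    ≡⟨ t′≥-split (suc (suc n)) (suc (suc ℓ)) ⟨
  t′≥ (suc (suc n)) (suc (suc ℓ))
    ≡⟨ t′-lastPeak (suc n) (suc (suc ℓ)) ⟨
  t′ (suc (suc (suc n))) (suc (suc (suc ℓ))) ∎
  where open ≡-Reasoning

agree : ∀ n → Agree n
agree zero    = agree-0
agree (suc n) = admitting-agrees n (agree n) , admitting₁-agrees n (agree n)

mainTheorem12 : (n k : ℕ) → t n k ≡ t′ n k
mainTheorem12 zero    k       = refl
mainTheorem12 (suc n) zero    = trans (t-zero (suc n)) (sym (t′-zero (suc n)))
mainTheorem12 (suc n) (suc k) = trans (t≡count-reach n k) (proj₁ (agree n) k)
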